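{- Let $\mathcal Z$ be a commutative associative unital $\mathbb Q$-algebra, $n,N\in\mathbb N$ with $2\le n\le N$, $z_j\in\mathcal Z$ for $j\in[N]$, $\widetilde z=\frac1N\sum_{j=1}^Nz_j$, and for $A\subseteq[N]$, $k\in\mathbb Z$ let $E_{A,k}=\sum_{J\subseteq A,\,|J|=k}\prod_{j\in J}z_j$. For $k\in[n]\setminus[2]$ let $\widetilde h_{k,n,N}=\dfrac{(n+k-2)(n-k+1)}{k(k-1)(k-2)\binom Nk}$. Then $$\frac1{\binom Nn}E_{[N],n}-\widetilde z^{\,n}+\frac{n(n-1)}{2N(N-1)}\sum_{j=1}^N(z_j-\widetilde z)^2\widetilde z^{\,n-2}=\frac1{2N^2}\sum_{(r,s,t)\in[N]^3_{\neq}}(z_r-z_s)^2(z_r-z_t)\sum_{k\in[n]\setminus[2]}\widetilde h_{k,n,N}\,\widetilde z^{\,n-k}E_{[N]\setminus\{r,s,t\},k-3}$$ $$+\frac1{8N^2}\sum_{(q,r,s,t)\in[N]^4_{\neq}}(z_q-z_r)^2(z_s-z_t)^2\sum_{k\in[n]\setminus[3]}\widetilde h_{k,n,N}\,\widetilde z^{\,n-k}E_{[N]\setminus\{q,r,s,t\},k-4},$$ where for $n=2$ the right-hand side is defined to be zero.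
   Context: $[m]=\{1,\dots,m\}$. $[N]^m_{\neq}$ is the set of $m$-tuples of pairwise distinct elements of $[N]$. $E_{A,0}=1$ and $E_{A,k}=0$ for $k<0$ or $k>|A|$. Empty sums are $0$; $\widetilde z^{\,0}=1$. -}

module Defs where

open import Level using (Level; _⊔_) renaming (suc to lsuc)
open import Data.Bool using (Bool; true; false; if_then_else_; _∧_; not; _∨_)
open import Data.Nat as ℕ using (ℕ; zero; suc; _<?_)
open import Data.Nat.Combinatorics using (_C_)
open import Data.Integer as ℤ using (ℤ; +_)
open import Data.Rational as ℚ using (ℚ; 0ℚ)
open import Data.Fin using (Fin)
open import Data.Fin.Subset using (Subset; ∣_∣)
open import Data.Fin.Subset.Properties using (_⊆?_)
open import Data.Fin.Properties using () renaming (_≟_ to _≟ᶠ_)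
open import Data.Vec using (Vec; []; _∷_; lookup; tabulate)
open import Data.List using (List; []; _∷_; [_]; _++_; map; foldr; filter; applyUpTo; allFin)
open import Relation.Nullary using (does)
open import Algebra.Bundles using (CommutativeRing)
open import Algebra.Morphism.Structures using (module RingMorphisms)

-- A commutative associative unital ℚ-algebra: a commutative ring together
-- with a unital ring homomorphism from ℚ into it (ℚ-action x ↦ φ q * x).
record QAlgebra (c ℓ : Level) : Set (lsuc (c ⊔ ℓ)) where
  field
    commRing : CommutativeRing c ℓ
  open CommutativeRing commRing public
  field
    φ     : ℚ → Carrier
    φ-hom : RingMorphisms.IsRingHomomorphism ℚ.+-*-rawRing rawRing φ

-- the rational number a / d  (only used with d ≠ 0; a / 0 := 0 is a dummy)
frac : ℕ → ℕ → ℚ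
frac a zero    = 0ℚ
frac a (suc d) = (+ a) ℚ./ suc d

[_]∖[_] : ℕ → ℕ → List ℕ
[ n ]∖[ m ] = filter (m <?_) (applyUpTo suc n)

allSubsets : (n : ℕ) → List (Subset n)
allSubsets zero    = [ [] ]
allSubsets (suc n) = map (false ∷_) (allSubsets n) ++ map (true ∷_) (allSubsets n)

removing : {N : ℕ} → List (Fin N) → Subset N
removing is = tabulate (λ j → not (foldr (λ i b → does (j ≟ᶠ i) ∨ b) false is))

h̃ : ℕ → ℕ → ℕ → ℚ
h̃ k n N = frac ((n ℕ.+ k ℕ.∸ 2) ℕ.* (n ℕ.∸ k ℕ.+ 1))
               (k ℕ.* (k ℕ.∸ 1) ℕ.* (k ℕ.∸ 2) ℕ.* (N C k))

module Formulas {c ℓ : Level} (𝒜 : QAlgebra c ℓ) where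
  open QAlgebra 𝒜

  ∑ : {X : Set} → List X → (X → Carrier) → Carrier
  ∑ xs f = foldr (λ x acc → f x + acc) 0# xs

  ∏ : {X : Set} → List X → (X → Carrier) → Carrier
  ∏ xs f = foldr (λ x acc → f x * acc) 1# xs

  pow : Carrier → ℕ → Carrier
  pow x zero    = 1#
  pow x (suc m) = x * pow x m

  sq : Carrier → Carrier
  sq x = x * x

  module _ {N : ℕ} (z : Fin N → Carrier) where

    prodOver : Subset N → Carrier
    prodOver J = ∏ (allFin N) (λ j → if lookup J j then z j else 1#)

    E : Subset N → ℤ → Carrier
    E A k = ∑ (allSubsets N)
              (λ J → if does (J ⊆? A) ∧ does (+ ∣ J ∣ ℤ.≟ k) then prodOver J else 0#)

    z̃ : Carrier
    z̃ = φ (frac 1 N) * ∑ (allFin N) z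

    ∑≠3 : (Fin N → Fin N → Fin N → Carrier) → Carrier
    ∑≠3 f = ∑ (allFin N) λ r → ∑ (allFin N) λ s → ∑ (allFin N) λ t →
      if not (does (r ≟ᶠ s) ∨ does (r ≟ᶠ t) ∨ does (s ≟ᶠ t)) then f r s t else 0#

    ∑≠4 : (Fin N → Fin N → Fin N → Fin N → Carrier) → Carrier
    ∑≠4 f = ∑ (allFin N) λ q → ∑ (allFin N) λ r → ∑ (allFin N) λ s → ∑ (allFin N) λ t →
      if not (does (q ≟ᶠ r) ∨ does (q ≟ᶠ s) ∨ does (q ≟ᶠ t)
              ∨ does (r ≟ᶠ s) ∨ does (r ≟ᶠ t) ∨ does (s ≟ᶠ t))
      then f q r s t else 0#

module Submission where

-- Write e_k for the elementary symmetric polynomials of z, μ for its mean and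
-- τ_m = ∑_{r,s} (z_r − z_s)² e_m(z without r, s). Counting monomials gives
-- τ_m = 2((N − m − 1) N μ e_{m+1} − (m + 2) N e_{m+2}), so the normalised means Ê_k = e_k / C(N,k) satisfy
-- Ê_{m+2} = μ Ê_{m+1} − τ_m / (2N (m + 2) C(N, m + 2)). Expanding
-- ∑_{r,s} (z_r − z_s)² ∑_{t ∉ {r,s}} (z_t − μ) e_m(z without r, s, t) in two ways, once by the same counting and
-- once through N(z_t − μ) = ∑_q (z_t − z_q) followed by symmetrisation in t and q, yields the recursion
-- (m + 1) τ_{m+1} = μ (N − m − 2) τ_m − 4N B_m, where B_m collects the triple and quadruple sums of the
-- right-hand side. Solving it expresses τ_m through μ^m τ_0, with τ_0 = 2N ∑_j (z_j − μ)², and the B_j;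
-- substituted into the recursion for Ê this proves the identity by induction on n, the weights h̃_{k,n,N}
-- being exactly the solution of the resulting recursion in n.

open import Defs
open import Level using (Level)
open import Function using (_∘_; flip)
open import Data.Bool using (Bool; true; false; if_then_else_; _∧_; _∨_; not)
open import Data.Bool.Properties using (∨-comm; ∨-commutativeMonoid)
open import Data.Nat as ℕ using (ℕ; zero; suc; NonZero; _≤_; _<_; _<?_; s≤s; z≤n; z<s)
import Data.Nat.Properties as ℕ
open import Data.Nat.Combinatorics using (_C_; nCk+nC[k+1]≡[n+1]C[k+1]; nC1≡n)
open import Data.Nat.Tactic.RingSolver using (solve-∀)
open import Data.Integer as ℤ using (+_; -[1+_])
import Data.Integer.Properties as ℤ
open import Data.Integer.Solver using (module +-*-Solver)
open import Data.Rational as ℚ using (ℚ; toℚᵘ)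
import Data.Rational.Properties as ℚ
open import Data.Rational.Unnormalised as ℚᵘ using (mkℚᵘ; *≡*)
import Data.Rational.Unnormalised.Properties as ℚᵘ
open import Data.Fin using (Fin; zero; suc)
open import Data.Fin.Properties using () renaming (_≟_ to _≟ᶠ_)
open import Data.Fin.Subset using (Subset; ⊤; ∣_∣)
open import Data.Fin.Subset.Properties using (_⊆?_)
open import Data.Vec using ([]; _∷_; lookup)
open import Data.Vec.Properties using (lookup∘tabulate; lookup-replicate)
open import Data.List as List using (List; []; _∷_; _++_; allFin; applyUpTo; reverse)
open import Data.List.Properties using (filter-all; foldr-++; unfold-reverse)
open import Data.List.Relation.Unary.All.Properties using (applyUpTo⁺₁)
open import Data.Maybe using (Maybe; just; nothing)
open import Data.Product using (_,_)
open import Data.Empty using (⊥-elim)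
open import Relation.Nullary using (yes; no; does)
open import Relation.Nullary.Decidable using (dec-false)
open import Relation.Binary.PropositionalEquality as ≡ using (_≡_; _≢_)
open import Algebra.Morphism.Structures using (module RingMorphisms)
open import Algebra.Solver.Ring.AlmostCommutativeRing
  using (fromCommutativeRing; _-Raw-AlmostCommutative⟶_)
import Algebra.Solver.Ring
import Algebra.Solver.CommutativeMonoid as CommutativeMonoidSolver

-- Fractions and binomial coefficients

toℚᵘ-frac : ∀ a d → toℚᵘ (frac a (suc d)) ℚᵘ.≃ mkℚᵘ (+ a) d
toℚᵘ-frac a d = ℚ.toℚᵘ-fromℚᵘ (mkℚᵘ (+ a) d)

frac-cong-× : ∀ a b c d .{{_ : NonZero b}} .{{_ : NonZero d}} →
              a ℕ.* d ≡ c ℕ.* b → frac a b ≡ frac c d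
frac-cong-× a (suc b) c (suc d) ad≡cb = ℚ.toℚᵘ-injective
  (ℚᵘ.≃-trans (toℚᵘ-frac a b) (ℚᵘ.≃-trans (*≡* cross) (ℚᵘ.≃-sym (toℚᵘ-frac c d))))
  where
  cross : + a ℤ.* + suc d ≡ + c ℤ.* + suc b
  cross = ≡.trans (≡.sym (ℤ.pos-* a (suc d))) (≡.trans (≡.cong +_ ad≡cb) (ℤ.pos-* c (suc b)))

frac-* : ∀ a b c d .{{_ : NonZero b}} .{{_ : NonZero d}} →
         frac a b ℚ.* frac c d ≡ frac (a ℕ.* c) (b ℕ.* d)
frac-* a (suc b) c (suc d) = ℚ.toℚᵘ-injective (begin
  toℚᵘ (frac a (suc b) ℚ.* frac c (suc d))      ≈⟨ ℚ.toℚᵘ-homo-* (frac a (suc b)) (frac c (suc d)) ⟩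
  toℚᵘ (frac a (suc b)) ℚᵘ.* toℚᵘ (frac c (suc d)) ≈⟨ ℚᵘ.*-cong (toℚᵘ-frac a b) (toℚᵘ-frac c d) ⟩
  mkℚᵘ (+ a) b ℚᵘ.* mkℚᵘ (+ c) d                   ≈⟨ *≡* (≡.cong (ℤ._* + suc (d ℕ.+ b ℕ.* suc d)) (≡.sym (ℤ.pos-* a c))) ⟩
  mkℚᵘ (+ (a ℕ.* c)) (d ℕ.+ b ℕ.* suc d)          ≈⟨ toℚᵘ-frac (a ℕ.* c) (d ℕ.+ b ℕ.* suc d) ⟨
  toℚᵘ (frac (a ℕ.* c) (suc b ℕ.* suc d))         ∎)
  where open ℚᵘ.≃-Reasoning

frac-+ : ∀ a b d .{{_ : NonZero d}} → frac a d ℚ.+ frac b d ≡ frac (a ℕ.+ b) d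
frac-+ a b (suc d) = ℚ.toℚᵘ-injective (begin
  toℚᵘ (frac a (suc d) ℚ.+ frac b (suc d))      ≈⟨ ℚ.toℚᵘ-homo-+ (frac a (suc d)) (frac b (suc d)) ⟩
  toℚᵘ (frac a (suc d)) ℚᵘ.+ toℚᵘ (frac b (suc d)) ≈⟨ ℚᵘ.+-cong (toℚᵘ-frac a d) (toℚᵘ-frac b d) ⟩
  mkℚᵘ (+ a) d ℚᵘ.+ mkℚᵘ (+ b) d                   ≈⟨ *≡* cross ⟩
  mkℚᵘ (+ (a ℕ.+ b)) d                             ≈⟨ toℚᵘ-frac (a ℕ.+ b) d ⟨
  toℚᵘ (frac (a ℕ.+ b) (suc d))                   ∎)
  where
  open ℚᵘ.≃-Reasoning
  open +-*-Solver
  cross : (+ a ℤ.* + suc d ℤ.+ + b ℤ.* + suc d) ℤ.* + suc d ≡ + (a ℕ.+ b) ℤ.* + (suc d ℕ.* suc d)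
  cross = ≡.trans (solve 3 (λ a b e → (a :* e :+ b :* e) :* e := (a :+ b) :* (e :* e)) ≡.refl (+ a) (+ b) (+ suc d))
                (≡.sym (≡.cong₂ ℤ._*_ (ℤ.pos-+ a b) (ℤ.pos-* (suc d) (suc d))))

nCk>0 : ∀ {n k} → k ≤ n → n C k ℕ.> 0
nCk>0 {n}     {zero}  _         = z<s
nCk>0 {suc n} {suc k} (s≤s k≤n) =
  ℕ.<-≤-trans (nCk>0 k≤n) (ℕ.≤-trans (ℕ.m≤m+n (n C k) (n C suc k)) (ℕ.≤-reflexive (nCk+nC[k+1]≡[n+1]C[k+1] n k)))

[k+1]*[n+1]C[k+1]≡[n+1]*nCk : ∀ n k → suc k ℕ.* (suc n C suc k) ≡ suc n ℕ.* (n C k)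
[k+1]*[n+1]C[k+1]≡[n+1]*nCk zero    zero    = ≡.refl
[k+1]*[n+1]C[k+1]≡[n+1]*nCk zero    (suc k) = ℕ.*-zeroʳ (suc (suc k))
[k+1]*[n+1]C[k+1]≡[n+1]*nCk (suc n) zero    =
  ≡.trans (ℕ.*-identityˡ _) (≡.trans (nC1≡n (suc (suc n))) (≡.sym (ℕ.*-identityʳ _)))
[k+1]*[n+1]C[k+1]≡[n+1]*nCk (suc n) (suc k) = begin
  suc (suc k) ℕ.* (suc (suc n) C suc (suc k))
    ≡⟨ ≡.cong (suc (suc k) ℕ.*_) (≡.sym (nCk+nC[k+1]≡[n+1]C[k+1] (suc n) (suc k))) ⟩
  suc (suc k) ℕ.* (A ℕ.+ B)
    ≡⟨ expand k A B ⟩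
  A ℕ.+ suc k ℕ.* A ℕ.+ suc (suc k) ℕ.* B
    ≡⟨ ≡.cong₂ (λ x y → A ℕ.+ x ℕ.+ y) ([k+1]*[n+1]C[k+1]≡[n+1]*nCk n k) ([k+1]*[n+1]C[k+1]≡[n+1]*nCk n (suc k)) ⟩
  A ℕ.+ suc n ℕ.* (n C k) ℕ.+ suc n ℕ.* (n C suc k)
    ≡⟨ ℕ.+-assoc A _ _ ⟩
  A ℕ.+ (suc n ℕ.* (n C k) ℕ.+ suc n ℕ.* (n C suc k))
    ≡⟨ ≡.cong (A ℕ.+_) (≡.sym (ℕ.*-distribˡ-+ (suc n) (n C k) (n C suc k))) ⟩
  A ℕ.+ suc n ℕ.* (n C k ℕ.+ n C suc k)
    ≡⟨ ≡.cong (λ x → A ℕ.+ suc n ℕ.* x) (nCk+nC[k+1]≡[n+1]C[k+1] n k) ⟩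
  A ℕ.+ suc n ℕ.* A
    ≡⟨⟩
  suc (suc n) ℕ.* A ∎
  where
  open ≡.≡-Reasoning
  A = suc n C suc k
  B = suc n C suc (suc k)
  expand : ∀ k a b → suc (suc k) ℕ.* (a ℕ.+ b) ≡ a ℕ.+ suc k ℕ.* a ℕ.+ suc (suc k) ℕ.* b
  expand = solve-∀

[k+1]*nC[k+1]+[k+1]*nCk≡[n+1]*nCk : ∀ n k → suc k ℕ.* (n C suc k) ℕ.+ suc k ℕ.* (n C k) ≡ suc n ℕ.* (n C k)
[k+1]*nC[k+1]+[k+1]*nCk≡[n+1]*nCk n k = begin
  suc k ℕ.* (n C suc k) ℕ.+ suc k ℕ.* (n C k)  ≡⟨ ℕ.*-distribˡ-+ (suc k) (n C suc k) (n C k) ⟨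
  suc k ℕ.* (n C suc k ℕ.+ n C k)             ≡⟨ ≡.cong (suc k ℕ.*_) (ℕ.+-comm (n C suc k) (n C k)) ⟩
  suc k ℕ.* (n C k ℕ.+ n C suc k)             ≡⟨ ≡.cong (suc k ℕ.*_) (nCk+nC[k+1]≡[n+1]C[k+1] n k) ⟩
  suc k ℕ.* (suc n C suc k)                   ≡⟨ [k+1]*[n+1]C[k+1]≡[n+1]*nCk n k ⟩
  suc n ℕ.* (n C k)                           ∎
  where open ≡.≡-Reasoning

[k+2]*[k+1]*[n+2]C[k+2]≡[n+2]*[n+1]*nCk : ∀ n k →
  suc (suc k) ℕ.* suc k ℕ.* (suc (suc n) C suc (suc k)) ≡ suc (suc n) ℕ.* suc n ℕ.* (n C k)
[k+2]*[k+1]*[n+2]C[k+2]≡[n+2]*[n+1]*nCk n k = begin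
  suc (suc k) ℕ.* suc k ℕ.* (suc (suc n) C suc (suc k))
    ≡⟨ swap (suc (suc k)) (suc k) (suc (suc n) C suc (suc k)) ⟩
  suc k ℕ.* (suc (suc k) ℕ.* (suc (suc n) C suc (suc k)))
    ≡⟨ ≡.cong (suc k ℕ.*_) ([k+1]*[n+1]C[k+1]≡[n+1]*nCk (suc n) (suc k)) ⟩
  suc k ℕ.* (suc (suc n) ℕ.* (suc n C suc k))
    ≡⟨ ℕ.*-comm (suc k) _ ⟩
  suc (suc n) ℕ.* (suc n C suc k) ℕ.* suc k
    ≡⟨ ℕ.*-assoc (suc (suc n)) (suc n C suc k) (suc k) ⟩
  suc (suc n) ℕ.* ((suc n C suc k) ℕ.* suc k)
    ≡⟨ ≡.cong (suc (suc n) ℕ.*_) (≡.trans (ℕ.*-comm _ (suc k)) ([k+1]*[n+1]C[k+1]≡[n+1]*nCk n k)) ⟩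
  suc (suc n) ℕ.* (suc n ℕ.* (n C k))
    ≡⟨ ℕ.*-assoc (suc (suc n)) (suc n) (n C k) ⟨
  suc (suc n) ℕ.* suc n ℕ.* (n C k) ∎
  where
  open ≡.≡-Reasoning
  swap : ∀ a b c → a ℕ.* b ℕ.* c ≡ b ℕ.* (a ℕ.* c)
  swap = solve-∀

module _ where
  open import Data.Nat.Base using (_+_; _*_; _∸_)

  h̃-numerator-suc : ∀ j d → let n = 3 + j + d in
    (suc n + (3 + j) ∸ 2) * (suc n ∸ (3 + j) + 1) ≡ (n + (3 + j) ∸ 2) * (n ∸ (3 + j) + 1) + 2 * n
  h̃-numerator-suc j d = begin
    (suc (3 + j + d) + (3 + j) ∸ 2) * (suc (j + d) ∸ j + 1)
      ≡⟨ ≡.cong (λ x → (suc (3 + j + d) + (3 + j) ∸ 2) * (x + 1)) (≡.trans (ℕ.+-∸-assoc 1 (ℕ.m≤m+n j d)) (≡.cong suc (ℕ.m+n∸m≡n j d))) ⟩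
    (2 + (j + d) + (3 + j)) * (suc d + 1)
      ≡⟨ polynomial j d ⟩
    (1 + (j + d) + (3 + j)) * (d + 1) + 2 * (3 + j + d)
      ≡⟨ ≡.cong (λ x → (1 + (j + d) + (3 + j)) * (x + 1) + 2 * (3 + j + d)) (ℕ.m+n∸m≡n j d) ⟨
    (3 + j + d + (3 + j) ∸ 2) * ((j + d) ∸ j + 1) + 2 * (3 + j + d) ∎
    where
    open ≡.≡-Reasoning
    polynomial : ∀ j d → (2 + (j + d) + (3 + j)) * (suc d + 1) ≡ (1 + (j + d) + (3 + j)) * (d + 1) + 2 * (3 + j + d)
    polynomial = solve-∀

  h̃-numerator-diag : ∀ p → (3 + p + (3 + p) ∸ 2) * (3 + p ∸ (3 + p) + 1) ≡ 2 * (2 + p)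
  h̃-numerator-diag p = ≡.trans (≡.cong (λ x → (3 + p + (3 + p) ∸ 2) * (x + 1)) (ℕ.n∸n≡0 p)) (polynomial p)
    where
    polynomial : ∀ p → (1 + p + (3 + p)) * (0 + 1) ≡ 2 * (2 + p)
    polynomial = solve-∀

module SymmetricMeans {c ℓ : Level} (𝒜 : QAlgebra c ℓ) where

  open QAlgebra 𝒜 public hiding (zero)
  open Formulas 𝒜 public
  open RingMorphisms.IsRingHomomorphism φ-hom public
    using (+-homo; *-homo; -‿homo; 0#-homo; 1#-homo)
  open import Algebra.Properties.Semiring.Mult semiring public
    using (_×_; ×-homo-+; ×1-homo-*)
  open import Algebra.Properties.Ring ring public using (-0#≈0#)
  open import Relation.Binary.Reasoning.Setoid setoid public

  private
    φ-morphism : ℚ.+-*-rawRing -Raw-AlmostCommutative⟶ fromCommutativeRing commRing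
    φ-morphism = record
      { ⟦_⟧ = φ ; +-homo = +-homo ; *-homo = *-homo ; -‿homo = -‿homo
      ; 0-homo = 0#-homo ; 1-homo = 1#-homo }

    φ-≟ : ∀ p q → Maybe (φ p ≈ φ q)
    φ-≟ p q with p ℚ.≟ q
    ... | yes ≡.refl = just refl
    ... | no _       = nothing

  open Algebra.Solver.Ring ℚ.+-*-rawRing (fromCommutativeRing commRing) φ-morphism φ-≟ public
    using (solve; _:=_; con; _:+_; _:*_; _:-_; :-_)

  infix 6 _≐_

  _≐_ : ∀ {N} → Fin N → Fin N → Bool
  i ≐ j = does (i ≟ᶠ j)

  ≐-sym : ∀ {N} (i j : Fin N) → (i ≐ j) ≡ (j ≐ i)
  ≐-sym i j with i ≟ᶠ j | j ≟ᶠ i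
  ... | yes _   | yes _   = ≡.refl
  ... | no  _   | no  _   = ≡.refl
  ... | yes i≡j | no  j≢i = ⊥-elim (j≢i (≡.sym i≡j))
  ... | no  i≢j | yes j≡i = ⊥-elim (i≢j (≡.sym j≡i))

  distinct₃-split : ∀ {N} (r s t : Fin N) → (r ≐ s ∨ r ≐ t ∨ s ≐ t) ≡ r ≐ s ∨ (t ≐ r ∨ t ≐ s)
  distinct₃-split r s t rewrite ≐-sym r t | ≐-sym s t = ≡.refl

  distinct₄-split : ∀ {N} (a b c d : Fin N) → (a ≐ b ∨ a ≐ c ∨ a ≐ d ∨ b ≐ c ∨ b ≐ d ∨ c ≐ d)
                                             ≡ a ≐ b ∨ ((c ≐ a ∨ c ≐ b) ∨ ((d ≐ a ∨ d ≐ b) ∨ d ≐ c))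
  distinct₄-split a b c d rewrite ≐-sym a c | ≐-sym a d | ≐-sym b c | ≐-sym b d | ≐-sym c d =
    regroup (a ≐ b) (c ≐ a) (d ≐ a) (c ≐ b) (d ≐ b) (d ≐ c)
    where
    open CommutativeMonoidSolver ∨-commutativeMonoid using (_⊕_; _⊜_) renaming (solve to solve-∨)
    regroup : ∀ x₁ x₂ x₃ x₄ x₅ x₆ → (x₁ ∨ x₂ ∨ x₃ ∨ x₄ ∨ x₅ ∨ x₆) ≡ x₁ ∨ ((x₂ ∨ x₄) ∨ ((x₃ ∨ x₅) ∨ x₆))
    regroup = solve-∨ 6 (λ x₁ x₂ x₃ x₄ x₅ x₆ → x₁ ⊕ (x₂ ⊕ (x₃ ⊕ (x₄ ⊕ (x₅ ⊕ x₆))))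
                                             ⊜ x₁ ⊕ ((x₂ ⊕ x₄) ⊕ ((x₃ ⊕ x₅) ⊕ x₆))) ≡.refl

  ι : ℕ → Carrier
  ι n = n × 1#

  ι-1 : ι 1 ≈ 1#
  ι-1 = +-identityʳ 1#

  -- Numerals are written through φ so that the ring solver, whose constants are rationals, can compute with them.
  ι-suc : ∀ n → ι (suc n) ≈ φ ℚ.1ℚ + ι n
  ι-suc n = +-congʳ (sym 1#-homo)

  𝟐 : Carrier
  𝟐 = φ (frac 2 1)

  ι-+ : ∀ m n → ι (m ℕ.+ n) ≈ ι m + ι n
  ι-+ = ×-homo-+ 1#

  ι-* : ∀ m n → ι (m ℕ.* n) ≈ ι m * ι n
  ι-* = ×1-homo-*

  ι-cong : ∀ {m n} → m ≡ n → ι m ≈ ι n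
  ι-cong ≡.refl = refl

  ι-binomial-step : ∀ n k → (ι n - ι k) * ι (n C k) ≈ ι (suc k) * ι (n C suc k)
  ι-binomial-step n k = begin
    (ι n - ι k) * ι (n C k)
      ≈⟨ solve 3 (λ n k c → (n :- k) :* c := (con ℚ.1ℚ :+ n) :* c :- (con ℚ.1ℚ :+ k) :* c) refl (ι n) (ι k) (ι (n C k)) ⟩
    (φ ℚ.1ℚ + ι n) * ι (n C k) - (φ ℚ.1ℚ + ι k) * ι (n C k)
      ≈⟨ +-cong (*-congʳ (ι-suc n)) (-‿cong (*-congʳ (ι-suc k))) ⟨
    ι (suc n) * ι (n C k) - ι (suc k) * ι (n C k)
      ≈⟨ +-congʳ pascal ⟨
    ι (suc k) * ι (n C suc k) + ι (suc k) * ι (n C k) - ι (suc k) * ι (n C k)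
      ≈⟨ solve 2 (λ a b → a :+ b :- b := a) refl (ι (suc k) * ι (n C suc k)) (ι (suc k) * ι (n C k)) ⟩
    ι (suc k) * ι (n C suc k) ∎
    where
    pascal : ι (suc k) * ι (n C suc k) + ι (suc k) * ι (n C k) ≈ ι (suc n) * ι (n C k)
    pascal = begin
      ι (suc k) * ι (n C suc k) + ι (suc k) * ι (n C k)  ≈⟨ +-cong (ι-* (suc k) (n C suc k)) (ι-* (suc k) (n C k)) ⟨
      ι (suc k ℕ.* (n C suc k)) + ι (suc k ℕ.* (n C k))  ≈⟨ ι-+ (suc k ℕ.* (n C suc k)) (suc k ℕ.* (n C k)) ⟨
      ι (suc k ℕ.* (n C suc k) ℕ.+ suc k ℕ.* (n C k))    ≈⟨ ι-cong ([k+1]*nC[k+1]+[k+1]*nCk≡[n+1]*nCk n k) ⟩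
      ι (suc n ℕ.* (n C k))                             ≈⟨ ι-* (suc n) (n C k) ⟩
      ι (suc n) * ι (n C k)                             ∎

  φ-frac-cong : ∀ a b c d .{{_ : NonZero b}} .{{_ : NonZero d}} →
                a ℕ.* d ≡ c ℕ.* b → φ (frac a b) ≈ φ (frac c d)
  φ-frac-cong a b c d ad≡cb = reflexive (≡.cong φ (frac-cong-× a b c d ad≡cb))

  φ-frac-* : ∀ a b c d .{{_ : NonZero b}} .{{_ : NonZero d}} →
             φ (frac a b) * φ (frac c d) ≈ φ (frac (a ℕ.* c) (b ℕ.* d))
  φ-frac-* a b c d = trans (sym (*-homo (frac a b) (frac c d))) (reflexive (≡.cong φ (frac-* a b c d)))

  φ-frac-+ : ∀ a b d .{{_ : NonZero d}} → φ (frac a d) + φ (frac b d) ≈ φ (frac (a ℕ.+ b) d)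
  φ-frac-+ a b d = trans (sym (+-homo (frac a d) (frac b d))) (reflexive (≡.cong φ (frac-+ a b d)))

  φ-frac-1 : ∀ n → φ (frac n 1) ≈ ι n
  φ-frac-1 zero    = 0#-homo
  φ-frac-1 (suc n) = begin
    φ (frac (suc n) 1)         ≈⟨ φ-frac-+ 1 n 1 ⟨
    φ ℚ.1ℚ + φ (frac n 1)      ≈⟨ +-cong 1#-homo (φ-frac-1 n) ⟩
    1# + ι n                   ∎

  ι-*-φ-frac : ∀ a b d .{{_ : NonZero d}} → ι a * φ (frac b d) ≈ φ (frac (a ℕ.* b) d)
  ι-*-φ-frac a b d = begin
    ι a * φ (frac b d)                ≈⟨ *-congʳ (φ-frac-1 a) ⟨
    φ (frac a 1) * φ (frac b d)       ≈⟨ φ-frac-* a 1 b d ⟩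
    φ (frac (a ℕ.* b) (1 ℕ.* d))      ≈⟨ φ-frac-cong (a ℕ.* b) (1 ℕ.* d) (a ℕ.* b) d {{ℕ.m*n≢0 1 d}}
                                           (≡.cong (a ℕ.* b ℕ.*_) (≡.sym (ℕ.+-identityʳ d))) ⟩
    φ (frac (a ℕ.* b) d)              ∎

  ι-inverse : ∀ d .{{_ : NonZero d}} → ι d * φ (frac 1 d) ≈ 1#
  ι-inverse d = begin
    ι d * φ (frac 1 d)        ≈⟨ ι-*-φ-frac d 1 d ⟩
    φ (frac (d ℕ.* 1) d)      ≈⟨ φ-frac-cong (d ℕ.* 1) d 1 1 (≡.trans (ℕ.*-identityʳ (d ℕ.* 1)) (ℕ.*-comm d 1)) ⟩
    φ (frac 1 1)              ≈⟨ 1#-homo ⟩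
    1#                        ∎

  ι-cancelˡ : ∀ d .{{_ : NonZero d}} {x y} → ι d * x ≈ ι d * y → x ≈ y
  ι-cancelˡ d {x} {y} dx≈dy = begin
    x                       ≈⟨ cancel x ⟨
    φ (frac 1 d) * (ι d * x) ≈⟨ *-congˡ dx≈dy ⟩
    φ (frac 1 d) * (ι d * y) ≈⟨ cancel y ⟩
    y                       ∎
    where
    cancel : ∀ x → φ (frac 1 d) * (ι d * x) ≈ x
    cancel x = trans (sym (*-assoc _ _ _))
      (trans (*-congʳ (trans (*-comm _ _) (ι-inverse d))) (*-identityˡ x))

  ι-*-φ-frac-cancel : ∀ a b .{{_ : NonZero a}} .{{_ : NonZero b}} → ι a * φ (frac 1 (a ℕ.* b)) ≈ φ (frac 1 b)
  ι-*-φ-frac-cancel a b = trans (ι-*-φ-frac a 1 (a ℕ.* b) {{ℕ.m*n≢0 a b}})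
                                (φ-frac-cong (a ℕ.* 1) (a ℕ.* b) 1 b {{ℕ.m*n≢0 a b}} (cross a b))
    where
    cross : ∀ a b → a ℕ.* 1 ℕ.* b ≡ 1 ℕ.* (a ℕ.* b)
    cross = solve-∀

  φ-frac-binomial-step : ∀ n k → suc k ≤ n →
                         φ (frac 1 (suc k ℕ.* (n C suc k))) * (ι n - ι k) ≈ φ (frac 1 (n C k))
  φ-frac-binomial-step n k k<n = ι-cancelˡ (n C k) (begin
    ι (n C k) * (d * (ι n - ι k))      ≈⟨ solve 3 (λ a d x → a :* (d :* x) := d :* (x :* a)) refl (ι (n C k)) d (ι n - ι k) ⟩
    d * ((ι n - ι k) * ι (n C k))      ≈⟨ *-congˡ (trans (ι-binomial-step n k) (sym (ι-* (suc k) (n C suc k)))) ⟩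
    d * ι (suc k ℕ.* (n C suc k))      ≈⟨ trans (*-comm _ _) (ι-inverse (suc k ℕ.* (n C suc k))) ⟩
    1#                                 ≈⟨ ι-inverse (n C k) ⟨
    ι (n C k) * φ (frac 1 (n C k))     ∎)
    where
    instance
      C[n,k]≢0 : NonZero (n C k)
      C[n,k]≢0 = ℕ.>-nonZero (nCk>0 (ℕ.<⇒≤ k<n))
      C[n,k+1]≢0 : NonZero (suc k ℕ.* (n C suc k))
      C[n,k+1]≢0 = ℕ.m*n≢0 (suc k) (n C suc k) {{_}} {{ℕ.>-nonZero (nCk>0 k<n)}}
    d = φ (frac 1 (suc k ℕ.* (n C suc k)))

  sq-self : ∀ a → sq (a - a) ≈ 0#
  sq-self a = trans (solve 1 (λ a → (a :- a) :* (a :- a) := con ℚ.0ℚ) refl a) 0#-homo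

  sq-self-* : ∀ a x → sq (a - a) * x ≈ 0#
  sq-self-* a x = trans (*-congʳ (sq-self a)) (zeroˡ x)

  twice≈0⇒≈0 : ∀ {x} → x + x ≈ 0# → x ≈ 0#
  twice≈0⇒≈0 {x} x+x≈0 = begin
    x                    ≈⟨ solve 1 (λ x → x := con ℚ.½ :* (x :+ x)) refl x ⟩
    φ ℚ.½ * (x + x)      ≈⟨ *-congˡ x+x≈0 ⟩
    φ ℚ.½ * 0#           ≈⟨ zeroʳ _ ⟩
    0#                   ∎

  -- Finite sums

  module _ {X : Set} where

    ∑-cong : ∀ (xs : List X) {f g : X → Carrier} → (∀ x → f x ≈ g x) → ∑ xs f ≈ ∑ xs g
    ∑-cong []       f≈g = refl
    ∑-cong (x ∷ xs) f≈g = +-cong (f≈g x) (∑-cong xs f≈g)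

    ∑-0 : ∀ (xs : List X) → ∑ xs (λ _ → 0#) ≈ 0#
    ∑-0 []       = refl
    ∑-0 (x ∷ xs) = trans (+-identityˡ _) (∑-0 xs)

    ∑-+ : ∀ (xs : List X) (f g : X → Carrier) → ∑ xs (λ x → f x + g x) ≈ ∑ xs f + ∑ xs g
    ∑-+ []       f g = sym (+-identityˡ 0#)
    ∑-+ (x ∷ xs) f g = trans (+-congˡ (∑-+ xs f g))
      (solve 4 (λ a b c d → (a :+ b) :+ (c :+ d) := (a :+ c) :+ (b :+ d)) refl (f x) (g x) (∑ xs f) (∑ xs g))

    ∑-*ˡ : ∀ (xs : List X) (a : Carrier) (f : X → Carrier) → ∑ xs (λ x → a * f x) ≈ a * ∑ xs f
    ∑-*ˡ []       a f = sym (zeroʳ a)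
    ∑-*ˡ (x ∷ xs) a f = trans (+-congˡ (∑-*ˡ xs a f)) (sym (distribˡ a (f x) (∑ xs f)))

    ∑-neg : ∀ (xs : List X) (f : X → Carrier) → ∑ xs (λ x → - f x) ≈ - ∑ xs f
    ∑-neg []       f = sym -0#≈0#
    ∑-neg (x ∷ xs) f = trans (+-congˡ (∑-neg xs f))
      (solve 2 (λ a b → :- a :+ :- b := :- (a :+ b)) refl (f x) (∑ xs f))

    ∑-- : ∀ (xs : List X) (f g : X → Carrier) → ∑ xs (λ x → f x - g x) ≈ ∑ xs f - ∑ xs g
    ∑-- xs f g = trans (∑-+ xs f (λ x → - g x)) (+-congˡ (∑-neg xs g))

    ∑-++ : ∀ (xs ys : List X) (f : X → Carrier) → ∑ (xs ++ ys) f ≈ ∑ xs f + ∑ ys f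
    ∑-++ []       ys f = sym (+-identityˡ _)
    ∑-++ (x ∷ xs) ys f = trans (+-congˡ (∑-++ xs ys f)) (sym (+-assoc _ _ _))

  ∑-comm : ∀ {X Y : Set} (xs : List X) (ys : List Y) (f : X → Y → Carrier) →
           ∑ xs (λ x → ∑ ys (f x)) ≈ ∑ ys (λ y → ∑ xs (λ x → f x y))
  ∑-comm []       ys f = sym (∑-0 ys)
  ∑-comm (x ∷ xs) ys f = trans (+-congˡ (∑-comm xs ys f)) (sym (∑-+ ys (f x) (λ y → ∑ xs (λ x → f x y))))

  ∑-allFin-suc : ∀ N (f : Fin (suc N) → Carrier) → ∑ (allFin (suc N)) f ≡ f zero + ∑ (allFin N) (f ∘ suc)
  ∑-allFin-suc N f = ≡.cong (λ y → f zero + y) (∑-tabulate suc f)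
    where
    ∑-tabulate : ∀ {X : Set} {n} (g : Fin n → X) (f : X → Carrier) → ∑ (List.tabulate g) f ≡ ∑ (allFin n) (f ∘ g)
    ∑-tabulate {n = zero}  g f = ≡.refl
    ∑-tabulate {n = suc n} g f = ≡.cong (λ y → f (g zero) + y)
      (≡.trans (∑-tabulate (g ∘ suc) f) (≡.sym (∑-tabulate suc (f ∘ g))))

  ∑-const : ∀ N (a : Carrier) → ∑ (allFin N) (λ _ → a) ≈ ι N * a
  ∑-const zero    a = sym (zeroˡ a)
  ∑-const (suc N) a = begin
    ∑ (allFin (suc N)) (λ _ → a)  ≡⟨ ∑-allFin-suc N (λ _ → a) ⟩
    a + ∑ (allFin N) (λ _ → a)    ≈⟨ +-congˡ (∑-const N a) ⟩
    a + ι N * a                   ≈⟨ solve 2 (λ a n → a :+ n :* a := (con ℚ.1ℚ :+ n) :* a) refl a (ι N) ⟩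
    (φ ℚ.1ℚ + ι N) * a            ≈⟨ *-congʳ (ι-suc N) ⟨
    ι (suc N) * a                 ∎

  ∑-select : ∀ {N} (r : Fin N) (f : Fin N → Carrier) →
             ∑ (allFin N) (λ t → if t ≐ r then f t else 0#) ≈ f r
  ∑-select {suc N} zero f = begin
    ∑ (allFin (suc N)) (λ t → if t ≐ zero then f t else 0#)  ≡⟨ ∑-allFin-suc N _ ⟩
    f zero + ∑ (allFin N) (λ _ → 0#)                                 ≈⟨ +-congˡ (∑-0 (allFin N)) ⟩
    f zero + 0#                                                      ≈⟨ +-identityʳ (f zero) ⟩
    f zero                                                           ∎
  ∑-select {suc N} (suc r) f = begin
    ∑ (allFin (suc N)) (λ t → if t ≐ suc r then f t else 0#)       ≡⟨ ∑-allFin-suc N _ ⟩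
    0# + ∑ (allFin N) (λ t → if t ≐ r then f (suc t) else 0#)      ≈⟨ +-identityˡ _ ⟩
    ∑ (allFin N) (λ t → if t ≐ r then f (suc t) else 0#)           ≈⟨ ∑-select r (f ∘ suc) ⟩
    f (suc r)                                                              ∎

  ∑< : ℕ → (ℕ → Carrier) → Carrier
  ∑< zero    f = 0#
  ∑< (suc p) f = ∑< p f + f p

  ∑<-cong : ∀ p {f g : ℕ → Carrier} → (∀ j → j ℕ.< p → f j ≈ g j) → ∑< p f ≈ ∑< p g
  ∑<-cong zero    f≈g = refl
  ∑<-cong (suc p) f≈g = +-cong (∑<-cong p (λ j j<p → f≈g j (ℕ.m<n⇒m<1+n j<p))) (f≈g p ℕ.≤-refl)

  ∑<-0 : ∀ p {f : ℕ → Carrier} → (∀ j → f j ≈ 0#) → ∑< p f ≈ 0#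
  ∑<-0 zero    f≈0 = refl
  ∑<-0 (suc p) f≈0 = trans (+-cong (∑<-0 p f≈0) (f≈0 p)) (+-identityˡ 0#)

  ∑<-+ : ∀ p (f g : ℕ → Carrier) → ∑< p (λ j → f j + g j) ≈ ∑< p f + ∑< p g
  ∑<-+ zero    f g = sym (+-identityˡ 0#)
  ∑<-+ (suc p) f g = trans (+-congʳ (∑<-+ p f g))
    (solve 4 (λ a b c d → (a :+ b) :+ (c :+ d) := (a :+ c) :+ (b :+ d)) refl (∑< p f) (∑< p g) (f p) (g p))

  ∑<-*ˡ : ∀ p (a : Carrier) (f : ℕ → Carrier) → ∑< p (λ j → a * f j) ≈ a * ∑< p f
  ∑<-*ˡ zero    a f = sym (zeroʳ a)
  ∑<-*ˡ (suc p) a f = trans (+-congʳ (∑<-*ˡ p a f)) (sym (distribˡ a _ _))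

  ∑<-suc : ∀ p (f : ℕ → Carrier) → ∑< (suc p) f ≈ f 0 + ∑< p (f ∘ suc)
  ∑<-suc zero    f = trans (+-identityˡ _) (sym (+-identityʳ _))
  ∑<-suc (suc p) f = trans (+-congʳ (∑<-suc p f)) (+-assoc _ _ _)

  ∑-∑<-comm : ∀ {X : Set} (xs : List X) p (f : X → ℕ → Carrier) →
              ∑ xs (λ x → ∑< p (f x)) ≈ ∑< p (λ j → ∑ xs (λ x → f x j))
  ∑-∑<-comm xs zero    f = ∑-0 xs
  ∑-∑<-comm xs (suc p) f = trans (∑-+ xs _ _) (+-congʳ (∑-∑<-comm xs p f))

  ∑<-pow-suc : ∀ p (x : Carrier) (a : ℕ → Carrier) →
               ∑< (suc p) (λ j → pow x (suc p ℕ.∸ suc j) * a j) ≈ x * ∑< p (λ j → pow x (p ℕ.∸ suc j) * a j) + a p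
  ∑<-pow-suc p x a = +-cong
    (trans (∑<-cong p λ j j<p → trans (*-congʳ (pow-∸ j<p)) (*-assoc _ _ _)) (∑<-*ˡ p x _))
    (trans (*-congʳ (reflexive (≡.cong (pow x) (ℕ.n∸n≡0 p)))) (*-identityˡ (a p)))
    where
    pow-∸ : ∀ {j p} → j ℕ.< p → pow x (p ℕ.∸ j) ≈ x * pow x (p ℕ.∸ suc j)
    pow-∸ {j} {p} j<p = reflexive (≡.cong (pow x) (ℕ.+-∸-assoc 1 j<p))

  ∑-∑<-*ˡ : ∀ {X : Set} (xs : List X) p (H : ℕ → Carrier) (f : X → ℕ → Carrier) →
            ∑ xs (λ x → ∑< p (λ j → H j * f x j)) ≈ ∑< p (λ j → H j * ∑ xs (λ x → f x j))
  ∑-∑<-*ˡ xs p H f = trans (∑-∑<-comm xs p (λ x j → H j * f x j)) (∑<-cong p (λ j _ → ∑-*ˡ xs (H j) _))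

  *-∑< : ∀ p (H W : ℕ → Carrier) x → x * ∑< p (λ j → H j * W j) ≈ ∑< p (λ j → H j * (x * W j))
  *-∑< p H W x = trans (sym (∑<-*ˡ p x _)) (∑<-cong p (λ j _ →
    solve 3 (λ x h w → x :* (h :* w) := h :* (x :* w)) refl x (H j) (W j)))

  unless : Bool → Carrier → Carrier
  unless b x = if b then 0# else x

  unless-cong : ∀ b {x y} → x ≈ y → unless b x ≈ unless b y
  unless-cong true  x≈y = refl
  unless-cong false x≈y = x≈y

  unless-0# : ∀ b → unless b 0# ≈ 0#
  unless-0# true  = refl
  unless-0# false = refl

  unless-+ : ∀ b x y → unless b (x + y) ≈ unless b x + unless b y
  unless-+ true  x y = sym (+-identityˡ 0#)
  unless-+ false x y = refl

  unless-neg : ∀ b x → unless b (- x) ≈ - unless b x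
  unless-neg true  x = sym -0#≈0#
  unless-neg false x = refl

  *-unless : ∀ b x y → y * unless b x ≈ unless b (y * x)
  *-unless true  x y = zeroʳ y
  *-unless false x y = refl

  unless-∨ : ∀ a b x → unless (a ∨ b) x ≈ unless a (unless b x)
  unless-∨ true  b x = refl
  unless-∨ false b x = refl

  unless-≐ : ∀ {N} (r s : Fin N) {x} → (r ≡ s → x ≈ 0#) → unless (r ≐ s) x ≈ x
  unless-≐ r s x≈0 with r ≟ᶠ s
  ... | yes r≡s = sym (x≈0 r≡s)
  ... | no  _   = refl

  unless-∑< : ∀ b p (H Y : ℕ → Carrier) → unless b (∑< p (λ j → H j * Y j)) ≈ ∑< p (λ j → H j * unless b (Y j))
  unless-∑< true  p H Y = sym (∑<-0 p (λ j → zeroʳ (H j)))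
  unless-∑< false p H Y = refl

  if-not-∨ : ∀ a b x → (if not (a ∨ b) then x else 0#) ≈ unless a (unless b x)
  if-not-∨ true  b x = refl
  if-not-∨ false true  x = refl
  if-not-∨ false false x = refl

  if-*ʳ : ∀ (b : Bool) (x y : Carrier) → (if b then x else 0#) * y ≈ (if b then x * y else 0#)
  if-*ʳ true  x y = refl
  if-*ʳ false x y = zeroˡ y

  ∑-unless-split : ∀ {N} (B : Fin N → Bool) (r : Fin N) (f : Fin N → Carrier) →
                   ∑ (allFin N) (λ t → unless (B t) (f t))
                   ≈ ∑ (allFin N) (λ t → unless (B t ∨ t ≐ r) (f t)) + unless (B r) (f r)
  ∑-unless-split {N} B r f = begin
    ∑ (allFin N) (λ t → unless (B t) (f t))
      ≈⟨ ∑-cong (allFin N) split ⟩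
    ∑ (allFin N) (λ t → unless (B t ∨ t ≐ r) (f t) + (if t ≐ r then unless (B t) (f t) else 0#))
      ≈⟨ ∑-+ (allFin N) _ _ ⟩
    ∑ (allFin N) (λ t → unless (B t ∨ t ≐ r) (f t)) + ∑ (allFin N) (λ t → if t ≐ r then unless (B t) (f t) else 0#)
      ≈⟨ +-congˡ (∑-select r (λ t → unless (B t) (f t))) ⟩
    ∑ (allFin N) (λ t → unless (B t ∨ t ≐ r) (f t)) + unless (B r) (f r) ∎
    where
    split : ∀ t → unless (B t) (f t) ≈ unless (B t ∨ t ≐ r) (f t) + (if t ≐ r then unless (B t) (f t) else 0#)
    split t with B t | t ≐ r
    ... | true  | true  = sym (+-identityˡ 0#)
    ... | true  | false = sym (+-identityˡ 0#)
    ... | false | true  = sym (+-identityˡ _)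
    ... | false | false = sym (+-identityʳ _)

  ∑-split₂ : ∀ {N} {r s : Fin N} → r ≢ s → (f : Fin N → Carrier) →
             ∑ (allFin N) f ≈ ∑ (allFin N) (λ t → unless (t ≐ r ∨ t ≐ s) (f t)) + f s + f r
  ∑-split₂ {N} {r} {s} r≢s f = begin
    ∑ (allFin N) f
      ≈⟨ ∑-unless-split (λ _ → false) r f ⟩
    ∑ (allFin N) (λ t → unless (t ≐ r) (f t)) + f r
      ≈⟨ +-congʳ (∑-unless-split (_≐ r) s f) ⟩
    ∑ (allFin N) (λ t → unless (t ≐ r ∨ t ≐ s) (f t)) + unless (s ≐ r) (f s) + f r
      ≡⟨ ≡.cong (λ b → ∑ (allFin N) (λ t → unless (t ≐ r ∨ t ≐ s) (f t)) + unless b (f s) + f r)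
                (dec-false (s ≟ᶠ r) (r≢s ∘ ≡.sym)) ⟩
    ∑ (allFin N) (λ t → unless (t ≐ r ∨ t ≐ s) (f t)) + f s + f r ∎

  ∑-split₃ : ∀ {N} {r s t : Fin N} → r ≢ s → r ≢ t → s ≢ t → (f : Fin N → Carrier) →
             ∑ (allFin N) f ≈ ∑ (allFin N) (λ q → unless ((q ≐ r ∨ q ≐ s) ∨ q ≐ t) (f q)) + f t + f s + f r
  ∑-split₃ {N} {r} {s} {t} r≢s r≢t s≢t f = begin
    ∑ (allFin N) f
      ≈⟨ ∑-split₂ r≢s f ⟩
    ∑ (allFin N) (λ q → unless (q ≐ r ∨ q ≐ s) (f q)) + f s + f r
      ≈⟨ +-congʳ (+-congʳ (∑-unless-split (λ q → q ≐ r ∨ q ≐ s) t f)) ⟩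
    ∑ (allFin N) (λ q → unless ((q ≐ r ∨ q ≐ s) ∨ q ≐ t) (f q)) + unless (t ≐ r ∨ t ≐ s) (f t) + f s + f r
      ≡⟨ ≡.cong₂ (λ b b′ → ∑ (allFin N) (λ q → unless ((q ≐ r ∨ q ≐ s) ∨ q ≐ t) (f q)) + unless (b ∨ b′) (f t) + f s + f r)
                 (dec-false (t ≟ᶠ r) (r≢t ∘ ≡.sym)) (dec-false (t ≟ᶠ s) (s≢t ∘ ≡.sym)) ⟩
    ∑ (allFin N) (λ q → unless ((q ≐ r ∨ q ≐ s) ∨ q ≐ t) (f q)) + f t + f s + f r ∎

  -- Elementary symmetric polynomials

  infix 4 _≋_

  _≋_ : ∀ {N} (x y : Fin N → Carrier) → Set ℓ
  x ≋ y = ∀ i → x i ≈ y i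

  -- Zeroing a coordinate removes it: E_{[N] ∖ {j}, k} of the paper is esym (zeroAt j z) k.
  esym : ∀ {N} → (Fin N → Carrier) → ℕ → Carrier
  esym x       zero    = 1#
  esym {zero}  x (suc k) = 0#
  esym {suc N} x (suc k) = esym (x ∘ suc) (suc k) + x zero * esym (x ∘ suc) k

  esym-cong : ∀ {N} {x y : Fin N → Carrier} → x ≋ y → ∀ k → esym x k ≈ esym y k
  esym-cong x≋y zero = refl
  esym-cong {zero}  x≋y (suc k) = refl
  esym-cong {suc N} x≋y (suc k) =
    +-cong (esym-cong (x≋y ∘ suc) (suc k)) (*-cong (x≋y zero) (esym-cong (x≋y ∘ suc) k))

  zeroAt : ∀ {N} → Fin N → (Fin N → Carrier) → Fin N → Carrier
  zeroAt j x i = if i ≐ j then 0# else x i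

  zeroAt-cong : ∀ {N} (j : Fin N) {x y : Fin N → Carrier} → x ≋ y → zeroAt j x ≋ zeroAt j y
  zeroAt-cong j x≋y i with i ≐ j
  ... | true  = refl
  ... | false = x≋y i

  zeroAt-comm : ∀ {N} (a b : Fin N) (x : Fin N → Carrier) → zeroAt a (zeroAt b x) ≋ zeroAt b (zeroAt a x)
  zeroAt-comm a b x i with i ≐ a | i ≐ b
  ... | true  | true  = refl
  ... | true  | false = refl
  ... | false | true  = refl
  ... | false | false = refl

  zeroAt-idem : ∀ {N} (a : Fin N) (x : Fin N → Carrier) → zeroAt a (zeroAt a x) ≋ zeroAt a x
  zeroAt-idem a x i with i ≐ a
  ... | true  = refl
  ... | false = refl

  zeroAt-self : ∀ {N} (a : Fin N) (x : Fin N → Carrier) → zeroAt a x a ≈ 0#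
  zeroAt-self a x with a ≟ᶠ a
  ... | yes _ = refl
  ... | no a≢a = ⊥-elim (a≢a ≡.refl)

  zeroAt-zero : ∀ {N} (a : Fin N) (x : Fin N → Carrier) → x a ≈ 0# → zeroAt a x ≋ x
  zeroAt-zero a x xa≈0 i with i ≟ᶠ a
  ... | yes ≡.refl = sym xa≈0
  ... | no _       = refl

  split-at : ∀ {N} (r s : Fin N) (z : Fin N → Carrier) →
             z s ≈ zeroAt r z s + (if s ≐ r then z s else 0#)
  split-at r s z with s ≐ r
  ... | true  = sym (+-identityˡ _)
  ... | false = sym (+-identityʳ _)

  esym-head≈0 : ∀ {N} (x : Fin (suc N) → Carrier) → x zero ≈ 0# → ∀ k → esym x k ≈ esym (x ∘ suc) k
  esym-head≈0 x x₀≈0 zero    = refl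
  esym-head≈0 x x₀≈0 (suc k) = begin
    esym (x ∘ suc) (suc k) + x zero * esym (x ∘ suc) k  ≈⟨ +-congˡ (trans (*-congʳ x₀≈0) (zeroˡ _)) ⟩
    esym (x ∘ suc) (suc k) + 0#                         ≈⟨ +-identityʳ _ ⟩
    esym (x ∘ suc) (suc k)                              ∎

  esym-split : ∀ {N} (x : Fin N → Carrier) (j : Fin N) k →
               esym x (suc k) ≈ esym (zeroAt j x) (suc k) + x j * esym (zeroAt j x) k
  esym-split {suc N} x zero k =
    sym (+-cong (trans (+-congˡ (zeroˡ _)) (+-identityʳ _)) (*-congˡ (esym-head≈0 (zeroAt zero x) refl k)))
  esym-split {suc N} x (suc j) zero = begin
    esym xs 1 + x zero * 1#
      ≈⟨ +-congʳ (esym-split xs j zero) ⟩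
    (esym (zeroAt j xs) 1 + xs j * 1#) + x zero * 1#
      ≈⟨ solve 4 (λ a b c o → (a :+ b :* o) :+ c :* o := (a :+ c :* o) :+ b :* o) refl (esym (zeroAt j xs) 1) (xs j) (x zero) 1# ⟩
    (esym (zeroAt j xs) 1 + x zero * 1#) + xs j * 1# ∎
    where xs = x ∘ suc
  esym-split {suc N} x (suc j) (suc k) = begin
    esym xs (suc (suc k)) + x zero * esym xs (suc k)
      ≈⟨ +-cong (esym-split xs j (suc k)) (*-congˡ (esym-split xs j k)) ⟩
    (e₂ + xs j * e₁) + x zero * (e₁ + xs j * e₀)
      ≈⟨ solve 5 (λ a b c x₀ xⱼ → (a :+ xⱼ :* b) :+ x₀ :* (b :+ xⱼ :* c) := (a :+ x₀ :* b) :+ xⱼ :* (b :+ x₀ :* c))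
               refl e₂ e₁ e₀ (x zero) (xs j) ⟩
    (e₂ + x zero * e₁) + xs j * (e₁ + x zero * e₀) ∎
    where
    xs = x ∘ suc
    e₂ = esym (zeroAt j xs) (suc (suc k))
    e₁ = esym (zeroAt j xs) (suc k)
    e₀ = esym (zeroAt j xs) k

  ∑-*-esym-zeroAt : ∀ {N} (x : Fin N → Carrier) k →
                    ∑ (allFin N) (λ j → x j * esym (zeroAt j x) k) ≈ ι (suc k) * esym x (suc k)
  ∑-*-esym-zeroAt {zero}  x k = sym (zeroʳ _)
  ∑-*-esym-zeroAt {suc N} x zero = begin
    ∑ (allFin (suc N)) (λ j → x j * esym (zeroAt j x) 0) ≡⟨ ∑-allFin-suc N _ ⟩
    x zero * 1# + ∑ (allFin N) (λ j → xs j * 1#)      ≈⟨ +-congˡ (∑-*-esym-zeroAt xs zero) ⟩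
    x zero * 1# + ι 1 * esym xs 1                     ≈⟨ +-congˡ (trans (*-congʳ ι-1) (*-identityˡ _)) ⟩
    x zero * 1# + esym xs 1                           ≈⟨ +-comm _ _ ⟩
    esym xs 1 + x zero * 1#                           ≈⟨ trans (*-congʳ ι-1) (*-identityˡ _) ⟨
    ι 1 * esym x 1                                    ∎
    where xs = x ∘ suc
  ∑-*-esym-zeroAt {suc N} x (suc k) = begin
    ∑ (allFin (suc N)) (λ j → x j * esym (zeroAt j x) (suc k))
      ≡⟨ ∑-allFin-suc N _ ⟩
    x zero * esym (zeroAt zero x) (suc k) + ∑ (allFin N) (λ j → xs j * (eⱼ j (suc k) + x zero * eⱼ j k))
      ≈⟨ +-cong (*-congˡ (esym-head≈0 (zeroAt zero x) refl (suc k)))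
                (∑-cong (allFin N) (λ j → solve 4 (λ a b c d → a :* (b :+ c :* d) := a :* b :+ c :* (a :* d))
                                                   refl (xs j) (eⱼ j (suc k)) (x zero) (eⱼ j k))) ⟩
    x zero * esym xs (suc k) + ∑ (allFin N) (λ j → xs j * eⱼ j (suc k) + x zero * (xs j * eⱼ j k))
      ≈⟨ +-congˡ (∑-+ (allFin N) _ _) ⟩
    x zero * esym xs (suc k) + (∑ (allFin N) (λ j → xs j * eⱼ j (suc k)) + ∑ (allFin N) (λ j → x zero * (xs j * eⱼ j k)))
      ≈⟨ +-congˡ (+-cong (∑-*-esym-zeroAt xs (suc k))
                         (trans (∑-*ˡ (allFin N) (x zero) _) (*-congˡ (∑-*-esym-zeroAt xs k)))) ⟩
    x zero * esym xs (suc k) + (ι (2 ℕ.+ k) * esym xs (2 ℕ.+ k) + x zero * (ι (suc k) * esym xs (suc k)))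
      ≈⟨ +-congˡ (+-congʳ (*-congʳ (ι-suc (suc k)))) ⟩
    x zero * esym xs (suc k) + ((φ ℚ.1ℚ + ι (suc k)) * esym xs (2 ℕ.+ k) + x zero * (ι (suc k) * esym xs (suc k)))
      ≈⟨ solve 4 (λ x₀ e₁ i e₂ → x₀ :* e₁ :+ ((con ℚ.1ℚ :+ i) :* e₂ :+ x₀ :* (i :* e₁)) := (con ℚ.1ℚ :+ i) :* (e₂ :+ x₀ :* e₁))
               refl (x zero) (esym xs (suc k)) (ι (suc k)) (esym xs (2 ℕ.+ k)) ⟩
    (φ ℚ.1ℚ + ι (suc k)) * (esym xs (2 ℕ.+ k) + x zero * esym xs (suc k))
      ≈⟨ *-congʳ (ι-suc (suc k)) ⟨
    ι (2 ℕ.+ k) * esym x (2 ℕ.+ k) ∎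
    where
    xs = x ∘ suc
    eⱼ : Fin N → ℕ → Carrier
    eⱼ j = esym (zeroAt j xs)

  ∑-esym-zeroAt : ∀ {N} (x : Fin N → Carrier) k →
                  ∑ (allFin N) (λ j → esym (zeroAt j x) k) ≈ (ι N - ι k) * esym x k
  ∑-esym-zeroAt {N} x k = begin
    ∑ (allFin N) (λ j → esym (zeroAt j x) k)            ≈⟨ solve 2 (λ a b → a := (a :+ b) :- b) refl _ (ι k * esym x k) ⟩
    (∑ (allFin N) (λ j → esym (zeroAt j x) k) + ι k * esym x k) - ι k * esym x k
      ≈⟨ +-congʳ (counted k) ⟩
    ι N * esym x k - ι k * esym x k                      ≈⟨ solve 3 (λ a b e → a :* e :- b :* e := (a :- b) :* e) refl (ι N) (ι k) (esym x k) ⟩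
    (ι N - ι k) * esym x k                               ∎
    where
    counted : ∀ k → ∑ (allFin N) (λ j → esym (zeroAt j x) k) + ι k * esym x k ≈ ι N * esym x k
    counted zero = trans (+-cong (∑-const N 1#) (zeroˡ 1#)) (+-identityʳ _)
    counted (suc k) = begin
      ∑ (allFin N) (λ j → esym (zeroAt j x) (suc k)) + ι (suc k) * esym x (suc k)
        ≈⟨ +-congˡ (∑-*-esym-zeroAt x k) ⟨
      ∑ (allFin N) (λ j → esym (zeroAt j x) (suc k)) + ∑ (allFin N) (λ j → x j * esym (zeroAt j x) k)
        ≈⟨ ∑-+ (allFin N) _ _ ⟨
      ∑ (allFin N) (λ j → esym (zeroAt j x) (suc k) + x j * esym (zeroAt j x) k)
        ≈⟨ ∑-cong (allFin N) (λ j → esym-split x j k) ⟨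
      ∑ (allFin N) (λ j → esym x (suc k))
        ≈⟨ ∑-const N _ ⟩
      ι N * esym x (suc k) ∎

  -- The statement's E, removing and [ n ]∖[ m ]

  mask : ∀ {N} → Subset N → (Fin N → Carrier) → Fin N → Carrier
  mask A x i = if lookup A i then x i else 0#

  private
    ∏-allFin-suc : ∀ N (f : Fin (suc N) → Carrier) → ∏ (allFin (suc N)) f ≡ f zero * ∏ (allFin N) (f ∘ suc)
    ∏-allFin-suc N f = ≡.cong (f zero *_) (∏-tabulate suc f)
      where
      ∏-tabulate : ∀ {X : Set} {n} (g : Fin n → X) (f : X → Carrier) → ∏ (List.tabulate g) f ≡ ∏ (allFin n) (f ∘ g)
      ∏-tabulate {n = zero}  g f = ≡.refl
      ∏-tabulate {n = suc n} g f = ≡.cong (f (g zero) *_)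
        (≡.trans (∏-tabulate (g ∘ suc) f) (≡.sym (∏-tabulate suc (f ∘ g))))

    ∑-map : ∀ {X Y : Set} (g : X → Y) (xs : List X) (f : Y → Carrier) → ∑ (List.map g xs) f ≡ ∑ xs (f ∘ g)
    ∑-map g []       f = ≡.refl
    ∑-map g (x ∷ xs) f = ≡.cong (λ y → f (g x) + y) (∑-map g xs f)

  E-esym : ∀ {N} (z : Fin N → Carrier) (A : Subset N) k → E z A (ℤ.+ k) ≈ esym (mask A z) k
  E-esym {zero}  z [] zero    = +-identityʳ 1#
  E-esym {zero}  z [] (suc k) = +-identityʳ 0#
  E-esym {suc N} z (a ∷ A) k = begin
    E z (a ∷ A) (ℤ.+ k)
      ≈⟨ ∑-++ (List.map (false ∷_) Js) (List.map (true ∷_) Js) f ⟩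
    ∑ (List.map (false ∷_) Js) f + ∑ (List.map (true ∷_) Js) f
      ≡⟨ ≡.cong₂ _+_ (∑-map (false ∷_) Js f) (∑-map (true ∷_) Js f) ⟩
    ∑ Js (f ∘ (false ∷_)) + ∑ Js (f ∘ (true ∷_))
      ≈⟨ +-cong (trans (∑-cong Js without-head) (E-esym zs A k)) (with-head a k) ⟩
    esym (mask A zs) k + T a k
      ≈⟨ assemble a k ⟩
    esym (mask (a ∷ A) z) k ∎
    where
    Js = allSubsets N
    zs = z ∘ suc
    f : Subset (suc N) → Carrier
    f J = if does (J ⊆? (a ∷ A)) ∧ does (ℤ.+ ∣ J ∣ ℤ.≟ ℤ.+ k) then prodOver z J else 0#
    without-head : ∀ J → f (false ∷ J) ≈ (if does (J ⊆? A) ∧ does (ℤ.+ ∣ J ∣ ℤ.≟ ℤ.+ k) then prodOver zs J else 0#)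
    without-head J with does (J ⊆? A) ∧ does (ℤ.+ ∣ J ∣ ℤ.≟ ℤ.+ k)
    ... | true  = trans (reflexive (∏-allFin-suc N _)) (*-identityˡ _)
    ... | false = refl
    T : Bool → ℕ → Carrier
    T true  (suc k) = z zero * esym (mask A zs) k
    T _     _       = 0#
    with-head : ∀ a k → ∑ Js (λ J → if does ((true ∷ J) ⊆? (a ∷ A)) ∧ does (ℤ.+ suc ∣ J ∣ ℤ.≟ ℤ.+ k)
                                   then prodOver z (true ∷ J) else 0#)
                        ≈ T a k
    with-head false k = ∑-0 Js
    with-head true zero = trans (∑-cong Js (λ J → reflexive (vanish (does (J ⊆? A))))) (∑-0 Js)
      where
      vanish : ∀ b {x} → (if b ∧ false then x else 0#) ≡ 0#
      vanish true  = ≡.refl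
      vanish false = ≡.refl
    with-head true (suc k) = begin
      ∑ Js (λ J → if does (J ⊆? A) ∧ does (ℤ.+ ∣ J ∣ ℤ.≟ ℤ.+ k) then prodOver z (true ∷ J) else 0#)
        ≈⟨ ∑-cong Js (λ J → pull (does (J ⊆? A) ∧ does (ℤ.+ ∣ J ∣ ℤ.≟ ℤ.+ k)) J) ⟩
      ∑ Js (λ J → z zero * (if does (J ⊆? A) ∧ does (ℤ.+ ∣ J ∣ ℤ.≟ ℤ.+ k) then prodOver zs J else 0#))
        ≈⟨ ∑-*ˡ Js (z zero) _ ⟩
      z zero * E zs A (ℤ.+ k)
        ≈⟨ *-congˡ (E-esym zs A k) ⟩
      z zero * esym (mask A zs) k ∎
      where
      pull : ∀ b J → (if b then prodOver z (true ∷ J) else 0#) ≈ z zero * (if b then prodOver zs J else 0#)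
      pull true  J = reflexive (∏-allFin-suc N _)
      pull false J = sym (zeroʳ (z zero))
    assemble : ∀ a k → esym (mask A zs) k + T a k ≈ esym (mask (a ∷ A) z) k
    assemble true  zero    = +-identityʳ 1#
    assemble false zero    = +-identityʳ 1#
    assemble true  (suc k) = refl
    assemble false (suc k) = trans (+-identityʳ _) (sym (trans (+-congˡ (zeroˡ _)) (+-identityʳ _)))

  E-negative : ∀ {N} (z : Fin N → Carrier) (A : Subset N) k → E z A -[1+ k ] ≈ 0#
  E-negative {N} z A k = trans (∑-cong (allSubsets N) (λ J → vanish (does (J ⊆? A)))) (∑-0 (allSubsets N))
    where
    vanish : ∀ b {x} → (if b ∧ false then x else 0#) ≈ 0#
    vanish true  = refl
    vanish false = refl

  zeroAll : ∀ {N} → List (Fin N) → (Fin N → Carrier) → Fin N → Carrier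
  zeroAll is x = List.foldr zeroAt x is

  mask⊤ : ∀ {N} (x : Fin N → Carrier) → mask ⊤ x ≋ x
  mask⊤ {N} x i rewrite lookup-replicate {n = N} i true = refl

  mask-removing : ∀ {N} (is : List (Fin N)) (x : Fin N → Carrier) → mask (removing is) x ≋ zeroAll is x
  mask-removing is x i rewrite lookup∘tabulate (λ j → not (List.foldr (λ k b → j ≐ k ∨ b) false is)) i = pointwise is
    where
    pointwise : ∀ is → (if not (List.foldr (λ k b → i ≐ k ∨ b) false is) then x i else 0#) ≈ zeroAll is x i
    pointwise []       = refl
    pointwise (j ∷ is) with i ≐ j
    ... | true  = refl
    ... | false = pointwise is

  zeroAll-zeroAt : ∀ {N} (is : List (Fin N)) j (x : Fin N → Carrier) → zeroAll is (zeroAt j x) ≋ zeroAt j (zeroAll is x)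
  zeroAll-zeroAt []       j x i = refl
  zeroAll-zeroAt (k ∷ is) j x i = trans (zeroAt-cong k (zeroAll-zeroAt is j x) i) (zeroAt-comm k j (zeroAll is x) i)

  zeroAll-reverse : ∀ {N} (is : List (Fin N)) (x : Fin N → Carrier) → zeroAll (reverse is) x ≋ zeroAll is x
  zeroAll-reverse []       x i = refl
  zeroAll-reverse (j ∷ is) x i = begin
    zeroAll (reverse (j ∷ is)) x i          ≡⟨ ≡.cong (λ js → zeroAll js x i) (unfold-reverse j is) ⟩
    zeroAll (reverse is List.∷ʳ j) x i      ≡⟨ ≡.cong (λ y → y i) (foldr-++ zeroAt x (reverse is) (j ∷ [])) ⟩
    zeroAll (reverse is) (zeroAt j x) i     ≈⟨ zeroAll-reverse is (zeroAt j x) i ⟩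
    zeroAll is (zeroAt j x) i               ≈⟨ zeroAll-zeroAt is j x i ⟩
    zeroAt j (zeroAll is x) i               ∎

  mask-removing-reverse : ∀ {N} (is : List (Fin N)) (x : Fin N → Carrier) → mask (removing is) x ≋ zeroAll (reverse is) x
  mask-removing-reverse is x i = trans (mask-removing is x i) (sym (zeroAll-reverse is x i))

  ∑-applyUpTo : ∀ p (f : ℕ → ℕ) (g : ℕ → Carrier) → ∑ (applyUpTo f p) g ≈ ∑< p (g ∘ f)
  ∑-applyUpTo zero    f g = refl
  ∑-applyUpTo (suc p) f g = trans (+-congˡ (∑-applyUpTo p (f ∘ suc) g)) (sym (∑<-suc p (g ∘ f)))

  ∑-[2+p]∖[2] : ∀ p (g : ℕ → Carrier) → ∑ [ suc (suc p) ]∖[ 2 ] g ≈ ∑< p (λ j → g (3 ℕ.+ j))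
  ∑-[2+p]∖[2] p g = begin
    ∑ [ suc (suc p) ]∖[ 2 ] g
      ≡⟨ ≡.cong (λ ks → ∑ ks g) (filter-all (2 <?_) (applyUpTo⁺₁ (3 ℕ.+_) p (λ _ → s≤s (s≤s (s≤s z≤n))))) ⟩
    ∑ (applyUpTo (3 ℕ.+_) p) g                 ≈⟨ ∑-applyUpTo p (3 ℕ.+_) g ⟩
    ∑< p (λ j → g (3 ℕ.+ j))                   ∎

  ∑-[2+p]∖[3] : ∀ p (g : ℕ → Carrier) → g 3 ≈ 0# → ∑ [ suc (suc p) ]∖[ 3 ] g ≈ ∑< p (λ j → g (3 ℕ.+ j))
  ∑-[2+p]∖[3] zero    g g₃≈0 = refl
  ∑-[2+p]∖[3] (suc p) g g₃≈0 = begin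
    ∑ [ suc (suc (suc p)) ]∖[ 3 ] g
      ≡⟨ ≡.cong (λ ks → ∑ ks g) (filter-all (3 <?_) (applyUpTo⁺₁ (4 ℕ.+_) p (λ _ → s≤s (s≤s (s≤s (s≤s z≤n)))))) ⟩
    ∑ (applyUpTo (4 ℕ.+_) p) g                 ≈⟨ ∑-applyUpTo p (4 ℕ.+_) g ⟩
    ∑< p (λ j → g (4 ℕ.+ j))                   ≈⟨ trans (+-congʳ g₃≈0) (+-identityˡ _) ⟨
    g 3 + ∑< p (λ j → g (4 ℕ.+ j))             ≈⟨ ∑<-suc p (λ j → g (3 ℕ.+ j)) ⟨
    ∑< (suc p) (λ j → g (3 ℕ.+ j))             ∎

  -- Sums over pairs, triples and quadruples of indices

  module Pairs {N : ℕ} (z : Fin N → Carrier) where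

    S : Carrier
    S = ∑ (allFin N) z

    z∖₁ : Fin N → Fin N → Carrier
    z∖₁ r = zeroAt r z

    z∖₂ : Fin N → Fin N → Fin N → Carrier
    z∖₂ r s = zeroAt s (z∖₁ r)

    pairSum : ℕ → Carrier
    pairSum m = ∑ (allFin N) λ r → ∑ (allFin N) λ s → sq (z r - z s) * esym (z∖₂ r s) m

    ∑-esym-z∖₂ : ∀ r m → ∑ (allFin N) (λ s → esym (z∖₂ r s) m) ≈ (ι N - ι m) * esym (z∖₁ r) m
    ∑-esym-z∖₂ r = ∑-esym-zeroAt (z∖₁ r)

    ∑-*-esym-z∖₂ : ∀ r m → ∑ (allFin N) (λ s → z s * esym (z∖₂ r s) m)
                           ≈ ι (suc m) * esym (z∖₁ r) (suc m) + z r * esym (z∖₁ r) m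
    ∑-*-esym-z∖₂ r m = begin
      ∑ (allFin N) (λ s → z s * e s)
        ≈⟨ ∑-cong (allFin N) (λ s → trans (*-congʳ (split-at r s z)) (distribʳ _ _ _)) ⟩
      ∑ (allFin N) (λ s → z∖₁ r s * e s + (if s ≐ r then z s else 0#) * e s)
        ≈⟨ ∑-+ (allFin N) _ _ ⟩
      ∑ (allFin N) (λ s → z∖₁ r s * e s) + ∑ (allFin N) (λ s → (if s ≐ r then z s else 0#) * e s)
        ≈⟨ +-cong (∑-*-esym-zeroAt (z∖₁ r) m) (∑-cong (allFin N) (λ s → if-*ʳ (s ≐ r) (z s) (e s))) ⟩
      ι (suc m) * esym (z∖₁ r) (suc m) + ∑ (allFin N) (λ s → if s ≐ r then z s * e s else 0#)
        ≈⟨ +-congˡ (∑-select r (λ s → z s * e s)) ⟩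
      ι (suc m) * esym (z∖₁ r) (suc m) + z r * esym (z∖₂ r r) m
        ≈⟨ +-congˡ (*-congˡ (esym-cong (zeroAt-idem r z) m)) ⟩
      ι (suc m) * esym (z∖₁ r) (suc m) + z r * esym (z∖₁ r) m ∎
      where
      e : Fin N → Carrier
      e s = esym (z∖₂ r s) m

    S-*-esym : ∀ m → S * esym z (suc m) ≈ ι (2 ℕ.+ m) * esym z (2 ℕ.+ m) + ∑ (allFin N) (λ r → sq (z r) * esym (z∖₁ r) m)
    S-*-esym m = begin
      S * esym z (suc m)
        ≈⟨ trans (*-comm _ _) (sym (∑-*ˡ (allFin N) _ z)) ⟩
      ∑ (allFin N) (λ r → esym z (suc m) * z r)
        ≈⟨ ∑-cong (allFin N) (λ r → trans (*-comm _ _) (*-congˡ (esym-split z r m))) ⟩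
      ∑ (allFin N) (λ r → z r * (esym (z∖₁ r) (suc m) + z r * esym (z∖₁ r) m))
        ≈⟨ ∑-cong (allFin N) (λ r → solve 3 (λ a b c → a :* (b :+ a :* c) := a :* b :+ a :* a :* c)
                                            refl (z r) (esym (z∖₁ r) (suc m)) (esym (z∖₁ r) m)) ⟩
      ∑ (allFin N) (λ r → z r * esym (z∖₁ r) (suc m) + sq (z r) * esym (z∖₁ r) m)
        ≈⟨ ∑-+ (allFin N) _ _ ⟩
      ∑ (allFin N) (λ r → z r * esym (z∖₁ r) (suc m)) + ∑ (allFin N) (λ r → sq (z r) * esym (z∖₁ r) m)
        ≈⟨ +-congʳ (∑-*-esym-zeroAt z (suc m)) ⟩
      ι (2 ℕ.+ m) * esym z (2 ℕ.+ m) + ∑ (allFin N) (λ r → sq (z r) * esym (z∖₁ r) m) ∎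

    private
      Q : ℕ → Carrier
      Q m = ∑ (allFin N) (λ r → sq (z r) * esym (z∖₁ r) m)

      pairSum-row : ∀ m r →
        ∑ (allFin N) (λ s → sq (z r - z s) * esym (z∖₂ r s) m)
        ≈ (sq (z r) * ((ι N - ι m) * esym (z∖₁ r) m) + ∑ (allFin N) (λ s → sq (z s) * esym (z∖₂ r s) m))
          - 𝟐 * z r * (ι (suc m) * esym (z∖₁ r) (suc m) + z r * esym (z∖₁ r) m)
      pairSum-row m r = begin
        ∑ (allFin N) (λ s → sq (z r - z s) * e s)
          ≈⟨ ∑-cong (allFin N) (λ s → solve 3 (λ a b x → (a :- b) :* (a :- b) :* x
                                                       := (a :* a :* x :+ b :* b :* x) :- con (frac 2 1) :* a :* (b :* x))
                                                refl (z r) (z s) (e s)) ⟩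
        ∑ (allFin N) (λ s → (sq (z r) * e s + sq (z s) * e s) - 𝟐 * z r * (z s * e s))
          ≈⟨ trans (∑-- (allFin N) _ _) (+-cong (∑-+ (allFin N) _ _) (-‿cong (∑-*ˡ (allFin N) _ _))) ⟩
        (∑ (allFin N) (λ s → sq (z r) * e s) + ∑ (allFin N) (λ s → sq (z s) * e s))
          - 𝟐 * z r * ∑ (allFin N) (λ s → z s * e s)
          ≈⟨ +-cong (+-congʳ (trans (∑-*ˡ (allFin N) _ _) (*-congˡ (∑-esym-z∖₂ r m))))
                    (-‿cong (*-congˡ (∑-*-esym-z∖₂ r m))) ⟩
        (sq (z r) * ((ι N - ι m) * esym (z∖₁ r) m) + ∑ (allFin N) (λ s → sq (z s) * e s))
          - 𝟐 * z r * (ι (suc m) * esym (z∖₁ r) (suc m) + z r * esym (z∖₁ r) m) ∎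
        where
        e : Fin N → Carrier
        e s = esym (z∖₂ r s) m

      ∑∑-sq-esym-z∖₂ : ∀ m → ∑ (allFin N) (λ r → ∑ (allFin N) (λ s → sq (z s) * esym (z∖₂ r s) m))
                             ≈ ∑ (allFin N) (λ s → sq (z s) * ((ι N - ι m) * esym (z∖₁ s) m))
      ∑∑-sq-esym-z∖₂ m = trans (∑-comm (allFin N) (allFin N) _) (∑-cong (allFin N) λ s →
        trans (∑-*ˡ (allFin N) _ _)
              (*-congˡ (trans (∑-cong (allFin N) (λ r → esym-cong (zeroAt-comm s r z) m)) (∑-esym-z∖₂ s m))))

      pairSum-via-Q : ∀ m → pairSum m ≈ ((ι N - ι m) * Q m + (ι N - ι m) * Q m)
                                       - 𝟐 * (ι (suc m) * (ι (2 ℕ.+ m) * esym z (2 ℕ.+ m)) + Q m)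
      pairSum-via-Q m = begin
        pairSum m
          ≈⟨ ∑-cong (allFin N) (pairSum-row m) ⟩
        ∑ (allFin N) (λ r → (A r + ∑ (allFin N) (λ s → sq (z s) * esym (z∖₂ r s) m)) - C r)
          ≈⟨ trans (∑-- (allFin N) _ C) (+-congʳ (∑-+ (allFin N) A _)) ⟩
        (∑ (allFin N) A + ∑ (allFin N) (λ r → ∑ (allFin N) (λ s → sq (z s) * esym (z∖₂ r s) m))) - ∑ (allFin N) C
          ≈⟨ +-congʳ (+-congˡ (∑∑-sq-esym-z∖₂ m)) ⟩
        (∑ (allFin N) A + ∑ (allFin N) A) - ∑ (allFin N) C
          ≈⟨ +-cong (+-cong ∑A ∑A) (-‿cong ∑C) ⟩
        ((ι N - ι m) * Q m + (ι N - ι m) * Q m) - 𝟐 * (ι (suc m) * (ι (2 ℕ.+ m) * esym z (2 ℕ.+ m)) + Q m) ∎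
        where
        A C : Fin N → Carrier
        A r = sq (z r) * ((ι N - ι m) * esym (z∖₁ r) m)
        C r = 𝟐 * z r * (ι (suc m) * esym (z∖₁ r) (suc m) + z r * esym (z∖₁ r) m)
        ∑A : ∑ (allFin N) A ≈ (ι N - ι m) * Q m
        ∑A = trans (∑-cong (allFin N) (λ r → solve 3 (λ a b c → a :* (b :* c) := b :* (a :* c)) refl (sq (z r)) (ι N - ι m) _))
                   (∑-*ˡ (allFin N) _ _)
        ∑C : ∑ (allFin N) C ≈ 𝟐 * (ι (suc m) * (ι (2 ℕ.+ m) * esym z (2 ℕ.+ m)) + Q m)
        ∑C = begin
          ∑ (allFin N) C
            ≈⟨ ∑-cong (allFin N) (λ r → solve 5 (λ t x i a b → t :* x :* (i :* a :+ x :* b) := t :* (i :* (x :* a) :+ x :* x :* b))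
                                                refl 𝟐 (z r) (ι (suc m)) (esym (z∖₁ r) (suc m)) (esym (z∖₁ r) m)) ⟩
          ∑ (allFin N) (λ r → 𝟐 * (ι (suc m) * (z r * esym (z∖₁ r) (suc m)) + sq (z r) * esym (z∖₁ r) m))
            ≈⟨ trans (∑-*ˡ (allFin N) _ _) (*-congˡ (∑-+ (allFin N) _ _)) ⟩
          𝟐 * (∑ (allFin N) (λ r → ι (suc m) * (z r * esym (z∖₁ r) (suc m))) + Q m)
            ≈⟨ *-congˡ (+-congʳ (trans (∑-*ˡ (allFin N) _ _) (*-congˡ (∑-*-esym-zeroAt z (suc m))))) ⟩
          𝟐 * (ι (suc m) * (ι (2 ℕ.+ m) * esym z (2 ℕ.+ m)) + Q m) ∎

    pairSum-esym : ∀ m → pairSum m ≈ 𝟐 * ((ι N - ι (suc m)) * S * esym z (suc m) - ι (2 ℕ.+ m) * ι N * esym z (2 ℕ.+ m))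
    pairSum-esym m = begin
      pairSum m
        ≈⟨ pairSum-via-Q m ⟩
      ((ι N - ι m) * Q m + (ι N - ι m) * Q m) - 𝟐 * (ι (suc m) * (ι (2 ℕ.+ m) * e₂) + Q m)
        ≈⟨ +-cong (+-cong (*-cong n-m Q≈) (*-cong n-m Q≈)) (-‿cong (*-congˡ (+-congˡ Q≈))) ⟩
      ((ι N - (ι (suc m) - φ ℚ.1ℚ)) * (S * e₁ - ι (2 ℕ.+ m) * e₂) + (ι N - (ι (suc m) - φ ℚ.1ℚ)) * (S * e₁ - ι (2 ℕ.+ m) * e₂))
        - 𝟐 * (ι (suc m) * (ι (2 ℕ.+ m) * e₂) + (S * e₁ - ι (2 ℕ.+ m) * e₂))
        ≈⟨ solve 6 (λ n i₁ i₂ s e₁ e₂ →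
                    ((n :- (i₁ :- con ℚ.1ℚ)) :* (s :* e₁ :- i₂ :* e₂) :+ (n :- (i₁ :- con ℚ.1ℚ)) :* (s :* e₁ :- i₂ :* e₂))
                      :- con (frac 2 1) :* (i₁ :* (i₂ :* e₂) :+ (s :* e₁ :- i₂ :* e₂))
                    := con (frac 2 1) :* ((n :- i₁) :* s :* e₁ :- i₂ :* n :* e₂))
                   refl (ι N) (ι (suc m)) (ι (2 ℕ.+ m)) S e₁ e₂ ⟩
      𝟐 * ((ι N - ι (suc m)) * S * e₁ - ι (2 ℕ.+ m) * ι N * e₂) ∎
      where
      e₁ = esym z (suc m)
      e₂ = esym z (2 ℕ.+ m)
      n-m : ι N - ι m ≈ ι N - (ι (suc m) - φ ℚ.1ℚ)
      n-m = +-congˡ (-‿cong (trans (solve 2 (λ a o → a := (o :+ a) :- o) refl (ι m) (φ ℚ.1ℚ))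
                                   (+-congʳ (sym (ι-suc m)))))
      Q≈ : Q m ≈ S * e₁ - ι (2 ℕ.+ m) * e₂
      Q≈ = trans (solve 2 (λ a b → a := (b :+ a) :- b) refl (Q m) _) (+-congʳ (sym (S-*-esym m)))

  module Triples {N : ℕ} (z : Fin N → Carrier) (μ : Carrier) where

    open Pairs z public

    z∖₃ : Fin N → Fin N → Fin N → Fin N → Carrier
    z∖₃ r s t = zeroAt t (z∖₂ r s)

    centredTripleSum : ℕ → Carrier
    centredTripleSum m =
      ∑ (allFin N) λ r → ∑ (allFin N) λ s → sq (z r - z s) *
        ∑ (allFin N) (λ t → unless (t ≐ r ∨ t ≐ s) ((z t - μ) * esym (z∖₃ r s t) m))

    private
      unless-z≈z∖₂ : ∀ r s t → unless (t ≐ r ∨ t ≐ s) (z t) ≈ z∖₂ r s t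
      unless-z≈z∖₂ r s t with t ≐ r | t ≐ s
      ... | true  | true  = refl
      ... | true  | false = refl
      ... | false | true  = refl
      ... | false | false = refl

      z∖₂-first : ∀ r s → z∖₂ r s r ≈ 0#
      z∖₂-first r s with r ≐ s
      ... | true  = refl
      ... | false = zeroAt-self r z

      unless-centred : ∀ b a x → unless b ((a - μ) * x) ≈ unless b a * x - μ * unless b x
      unless-centred true  a x = sym (trans (+-cong (zeroˡ x) (-‿cong (zeroʳ μ))) (-‿inverseʳ 0#))
      unless-centred false a x = solve 3 (λ a x μ → (a :- μ) :* x := a :* x :- μ :* x) refl a x μ

    ∑-centred-esym : ∀ {r s} → r ≢ s → ∀ m →
      ∑ (allFin N) (λ t → unless (t ≐ r ∨ t ≐ s) ((z t - μ) * esym (z∖₃ r s t) m))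
      ≈ ι (suc m) * esym (z∖₂ r s) (suc m) - μ * (ι N - ι m - 𝟐) * esym (z∖₂ r s) m
    ∑-centred-esym {r} {s} r≢s m = begin
      ∑ (allFin N) (λ t → unless (in₂ t) ((z t - μ) * e t))
        ≈⟨ ∑-cong (allFin N) (λ t → trans (unless-centred (in₂ t) (z t) (e t)) (+-congʳ (*-congʳ (unless-z≈z∖₂ r s t)))) ⟩
      ∑ (allFin N) (λ t → z∖₂ r s t * e t - μ * unless (in₂ t) (e t))
        ≈⟨ trans (∑-- (allFin N) _ _) (+-cong (∑-*-esym-zeroAt (z∖₂ r s) m) (-‿cong (∑-*ˡ (allFin N) μ _))) ⟩
      ι (suc m) * esym (z∖₂ r s) (suc m) - μ * ∑ (allFin N) (λ t → unless (in₂ t) (e t))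
        ≈⟨ +-congˡ (-‿cong (*-congˡ count)) ⟩
      ι (suc m) * esym (z∖₂ r s) (suc m) - μ * ((ι N - ι m) * esym (z∖₂ r s) m - esym (z∖₂ r s) m - esym (z∖₂ r s) m)
        ≈⟨ solve 5 (λ a b μ n k → a :- μ :* ((n :- k) :* b :- b :- b) := a :- μ :* (n :- k :- con (frac 2 1)) :* b)
                 refl (ι (suc m) * esym (z∖₂ r s) (suc m)) (esym (z∖₂ r s) m) μ (ι N) (ι m) ⟩
      ι (suc m) * esym (z∖₂ r s) (suc m) - μ * (ι N - ι m - 𝟐) * esym (z∖₂ r s) m ∎
      where
      in₂ : Fin N → Bool
      in₂ t = t ≐ r ∨ t ≐ s
      e : Fin N → Carrier
      e t = esym (z∖₃ r s t) m
      count : ∑ (allFin N) (λ t → unless (in₂ t) (e t))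
              ≈ (ι N - ι m) * esym (z∖₂ r s) m - esym (z∖₂ r s) m - esym (z∖₂ r s) m
      count = begin
        ∑ (allFin N) (λ t → unless (in₂ t) (e t))
          ≈⟨ solve 3 (λ u a b → u := u :+ a :+ b :- b :- a) refl _ (e s) (e r) ⟩
        ∑ (allFin N) (λ t → unless (in₂ t) (e t)) + e s + e r - e r - e s
          ≈⟨ +-congʳ (+-congʳ (sym (∑-split₂ r≢s e))) ⟩
        ∑ (allFin N) e - e r - e s
          ≈⟨ +-cong (+-cong (∑-esym-zeroAt (z∖₂ r s) m)
                            (-‿cong (esym-cong (zeroAt-zero r (z∖₂ r s) (z∖₂-first r s)) m)))
                    (-‿cong (esym-cong (zeroAt-zero s (z∖₂ r s) (zeroAt-self s (z∖₁ r))) m)) ⟩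
        (ι N - ι m) * esym (z∖₂ r s) m - esym (z∖₂ r s) m - esym (z∖₂ r s) m ∎

    centredTripleSum-pairSum : ∀ m → centredTripleSum m ≈ ι (suc m) * pairSum (suc m) - μ * (ι N - ι m - 𝟐) * pairSum m
    centredTripleSum-pairSum m = begin
      centredTripleSum m
        ≈⟨ ∑-cong (allFin N) (λ r → ∑-cong (allFin N) (λ s → pointwise r s)) ⟩
      ∑ (allFin N) (λ r → ∑ (allFin N) (λ s → ι (suc m) * (sq (z r - z s) * esym (z∖₂ r s) (suc m))
                                               - K * (sq (z r - z s) * esym (z∖₂ r s) m)))
        ≈⟨ ∑-cong (allFin N) (λ r → trans (∑-- (allFin N) _ _) (+-cong (∑-*ˡ (allFin N) _ _) (-‿cong (∑-*ˡ (allFin N) _ _)))) ⟩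
      ∑ (allFin N) (λ r → ι (suc m) * ∑ (allFin N) (λ s → sq (z r - z s) * esym (z∖₂ r s) (suc m))
                         - K * ∑ (allFin N) (λ s → sq (z r - z s) * esym (z∖₂ r s) m))
        ≈⟨ trans (∑-- (allFin N) _ _) (+-cong (∑-*ˡ (allFin N) _ _) (-‿cong (∑-*ˡ (allFin N) _ _))) ⟩
      ι (suc m) * pairSum (suc m) - K * pairSum m ∎
      where
      K = μ * (ι N - ι m - 𝟐)
      pointwise : ∀ r s →
        sq (z r - z s) * ∑ (allFin N) (λ t → unless (t ≐ r ∨ t ≐ s) ((z t - μ) * esym (z∖₃ r s t) m))
        ≈ ι (suc m) * (sq (z r - z s) * esym (z∖₂ r s) (suc m)) - K * (sq (z r - z s) * esym (z∖₂ r s) m)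
      pointwise r s with r ≟ᶠ s
      ... | yes ≡.refl = begin
        sq (z r - z r) * _                  ≈⟨ sq-self-* (z r) _ ⟩
        0#                                  ≈⟨ -‿inverseʳ 0# ⟨
        0# - 0#                             ≈⟨ +-cong (vanish (ι (suc m)) (suc m)) (-‿cong (vanish K m)) ⟨
        ι (suc m) * (sq (z r - z r) * esym (z∖₂ r r) (suc m)) - K * (sq (z r - z r) * esym (z∖₂ r r) m) ∎
        where
        vanish : ∀ a k → a * (sq (z r - z r) * esym (z∖₂ r r) k) ≈ 0#
        vanish a k = trans (*-congˡ (sq-self-* (z r) _)) (zeroʳ a)
      ... | no r≢s = trans (*-congˡ (∑-centred-esym r≢s m))
        (solve 5 (λ q i a k b → q :* (i :* a :- k :* b) := i :* (q :* a) :- k :* (q :* b))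
               refl (sq (z r - z s)) (ι (suc m)) (esym (z∖₂ r s) (suc m)) K (esym (z∖₂ r s) m))

  module OffPairs {N : ℕ} (r s : Fin N) where

    in₂ : Fin N → Bool
    in₂ t = t ≐ r ∨ t ≐ s

    in₃ : Fin N → Fin N → Bool
    in₃ t q = in₂ q ∨ q ≐ t

    ∑∉ : (Fin N → Fin N → Carrier) → Carrier
    ∑∉ G = ∑ (allFin N) λ t → ∑ (allFin N) λ q → unless (in₂ t) (unless (in₃ t q) (G t q))

    ∑∉-cong-unless : ∀ {G H} → (∀ t q → unless (in₃ t q) (G t q) ≈ unless (in₃ t q) (H t q)) → ∑∉ G ≈ ∑∉ H
    ∑∉-cong-unless G≈H = ∑-cong (allFin N) λ t → ∑-cong (allFin N) λ q → unless-cong (in₂ t) (G≈H t q)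

    ∑∉-cong : ∀ {G H} → (∀ t q → G t q ≈ H t q) → ∑∉ G ≈ ∑∉ H
    ∑∉-cong G≈H = ∑∉-cong-unless (λ t q → unless-cong (in₃ t q) (G≈H t q))

    ∑∉-+ : ∀ G H → ∑∉ (λ t q → G t q + H t q) ≈ ∑∉ G + ∑∉ H
    ∑∉-+ G H = trans (∑-cong (allFin N) λ t → trans (∑-cong (allFin N) λ q →
                        trans (unless-cong (in₂ t) (unless-+ (in₃ t q) _ _)) (unless-+ (in₂ t) _ _))
                      (∑-+ (allFin N) _ _))
                    (∑-+ (allFin N) _ _)

    ∑∉-neg : ∀ G → ∑∉ (λ t q → - G t q) ≈ - ∑∉ G
    ∑∉-neg G = trans (∑-cong (allFin N) λ t → trans (∑-cong (allFin N) λ q →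
                        trans (unless-cong (in₂ t) (unless-neg (in₃ t q) _)) (unless-neg (in₂ t) _))
                      (∑-neg (allFin N) _))
                    (∑-neg (allFin N) _)

    ∑∉-0 : ∀ {G} → (∀ t q → G t q ≈ 0#) → ∑∉ G ≈ 0#
    ∑∉-0 G≈0 = trans (∑-cong (allFin N) λ t → trans (∑-cong (allFin N) λ q →
                        trans (unless-cong (in₂ t) (trans (unless-cong (in₃ t q) (G≈0 t q)) (unless-0# _))) (unless-0# _))
                      (∑-0 (allFin N)))
                    (∑-0 (allFin N))

    private
      unless-in-flip : ∀ t q x → unless (in₂ q) (unless (in₃ q t) x) ≈ unless (in₂ t) (unless (in₃ t q) x)
      unless-in-flip t q x with q ≐ r | q ≐ s | t ≐ r | t ≐ s
      ... | true  | _     | _     | _     = sym (unless-0# _)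
      ... | false | true  | _     | _     = sym (unless-0# _)
      ... | false | false | true  | _     = refl
      ... | false | false | false | true  = refl
      ... | false | false | false | false rewrite ≐-sym t q = refl

    ∑∉-flip : ∀ G → ∑∉ G ≈ ∑∉ (flip G)
    ∑∉-flip G = trans (∑-comm (allFin N) (allFin N) _)
                      (∑-cong (allFin N) λ t → ∑-cong (allFin N) λ q → unless-in-flip t q (G q t))

    ∑∉-antisym : ∀ G → (∀ t q → G q t ≈ - G t q) → ∑∉ G ≈ 0#
    ∑∉-antisym G anti = twice≈0⇒≈0 (begin
      ∑∉ G + ∑∉ G                   ≈⟨ +-congˡ (trans (∑∉-flip G) (∑∉-cong anti)) ⟩
      ∑∉ G + ∑∉ (λ t q → - G t q)   ≈⟨ +-congˡ (∑∉-neg G) ⟩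
      ∑∉ G - ∑∉ G                   ≈⟨ -‿inverseʳ _ ⟩
      0#                            ∎)

    ∑∉-symmetrize : ∀ G → ∑∉ G ≈ φ ℚ.½ * ∑∉ (λ t q → G t q + G q t)
    ∑∉-symmetrize G = begin
      ∑∉ G                               ≈⟨ solve 1 (λ x → x := con ℚ.½ :* (x :+ x)) refl _ ⟩
      φ ℚ.½ * (∑∉ G + ∑∉ G)              ≈⟨ *-congˡ (+-congˡ (∑∉-flip G)) ⟩
      φ ℚ.½ * (∑∉ G + ∑∉ (flip G))       ≈⟨ *-congˡ (∑∉-+ G (flip G)) ⟨
      φ ℚ.½ * ∑∉ (λ t q → G t q + G q t) ∎

  module Quadruples {N : ℕ} (z : Fin N → Carrier) (μ : Carrier) (mean : ι N * μ ≈ ∑ (allFin N) z) where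

    open Triples z μ public
    open OffPairs

    z∖₄ : Fin N → Fin N → Fin N → Fin N → Fin N → Carrier
    z∖₄ r s t q = zeroAt q (z∖₃ r s t)

    tripleSum : ℕ → Carrier
    tripleSum m = ∑ (allFin N) λ r → ∑ (allFin N) λ s → ∑ (allFin N) λ t →
      unless (in₂ r s t) (sq (z r - z s) * ((z r - z t) * esym (z∖₃ r s t) m))

    quadRow : ℕ → Fin N → Fin N → Carrier
    quadRow m r s = ∑∉ r s (λ t q → sq (z r - z s) * (sq (z t - z q) * esym (z∖₄ r s t q) m))

    -- quadSum m goes with E_{·, m − 1} in the statement, which vanishes for m = 0.
    quadSum : ℕ → Carrier
    quadSum zero    = 0#
    quadSum (suc m) = ∑ (allFin N) λ r → ∑ (allFin N) λ s → quadRow m r s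

    private
      e₃ : Fin N → Fin N → Fin N → ℕ → Carrier
      e₃ r s t = esym (z∖₃ r s t)

      tqRow : ℕ → Fin N → Fin N → Carrier
      tqRow m r s = ∑∉ r s (λ t q → sq (z r - z s) * ((z t - z q) * e₃ r s t m))

      tripleRow tripleRow′ : ℕ → Fin N → Fin N → Carrier
      tripleRow  m r s = ∑ (allFin N) λ t → unless (in₂ r s t) (sq (z r - z s) * ((z r - z t) * e₃ r s t m))
      tripleRow′ m r s = ∑ (allFin N) λ t → unless (in₂ r s t) (sq (z r - z s) * ((z s - z t) * e₃ r s t m))

      ∑0-0-0 : ∑ (allFin N) (λ _ → 0#) - 0# - 0# ≈ 0#
      ∑0-0-0 = trans (+-cong (+-cong (∑-0 (allFin N)) -0#≈0#) -0#≈0#) (trans (+-identityʳ _) (+-identityʳ _))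

      N*centred : ∀ t x → ι N * ((z t - μ) * x) ≈ ∑ (allFin N) (λ q → (z t - z q) * x)
      N*centred t x = sym (begin
        ∑ (allFin N) (λ q → (z t - z q) * x)     ≈⟨ ∑-cong (allFin N) (λ q → *-comm _ x) ⟩
        ∑ (allFin N) (λ q → x * (z t - z q))     ≈⟨ ∑-*ˡ (allFin N) x _ ⟩
        x * ∑ (allFin N) (λ q → z t - z q)       ≈⟨ *-congˡ (∑-- (allFin N) (λ _ → z t) z) ⟩
        x * (∑ (allFin N) (λ _ → z t) - S)       ≈⟨ *-congˡ (+-cong (∑-const N (z t)) (-‿cong (sym mean))) ⟩
        x * (ι N * z t - ι N * μ)                ≈⟨ solve 4 (λ x n a μ → x :* (n :* a :- n :* μ) := n :* ((a :- μ) :* x)) refl x (ι N) (z t) μ ⟩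
        ι N * ((z t - μ) * x)                    ∎)

      deviation-row : ∀ {r s} → r ≢ s → ∀ m t →
        sq (z r - z s) * unless (in₂ r s t) (∑ (allFin N) (λ q → (z t - z q) * e₃ r s t m))
        ≈ ∑ (allFin N) (λ q → unless (in₂ r s t) (unless (in₃ r s t q) (sq (z r - z s) * ((z t - z q) * e₃ r s t m))))
          - unless (in₂ r s t) (sq (z r - z s) * ((z r - z t) * e₃ r s t m))
          - unless (in₂ r s t) (sq (z r - z s) * ((z s - z t) * e₃ r s t m))
      deviation-row {r} {s} r≢s m t with t ≟ᶠ r | t ≟ᶠ s
      ... | yes _ | _     = trans (zeroʳ _) (sym ∑0-0-0)
      ... | no _  | yes _ = trans (zeroʳ _) (sym ∑0-0-0)
      ... | no t≢r | no t≢s = begin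
        D * ∑ (allFin N) g
          ≈⟨ *-congˡ (∑-split₃ r≢s (t≢r ∘ ≡.sym) (t≢s ∘ ≡.sym) g) ⟩
        D * (∑ (allFin N) (λ q → unless (in₃ r s t q) (g q)) + g t + g s + g r)
          ≈⟨ solve 6 (λ D U zt zs zr e → D :* (U :+ (zt :- zt) :* e :+ (zt :- zs) :* e :+ (zt :- zr) :* e)
                                          := D :* U :- D :* ((zr :- zt) :* e) :- D :* ((zs :- zt) :* e))
                   refl D _ (z t) (z s) (z r) (e₃ r s t m) ⟩
        D * ∑ (allFin N) (λ q → unless (in₃ r s t q) (g q)) - D * ((z r - z t) * e₃ r s t m) - D * ((z s - z t) * e₃ r s t m)
          ≈⟨ +-congʳ (+-congʳ (trans (sym (∑-*ˡ (allFin N) D _)) (∑-cong (allFin N) (λ q → *-unless (in₃ r s t q) (g q) D)))) ⟩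
        ∑ (allFin N) (λ q → unless (in₃ r s t q) (D * g q)) - D * ((z r - z t) * e₃ r s t m) - D * ((z s - z t) * e₃ r s t m) ∎
        where
        D = sq (z r - z s)
        g : Fin N → Carrier
        g q = (z t - z q) * e₃ r s t m

      N*centredTripleRow : ∀ m r s →
        ι N * (sq (z r - z s) * ∑ (allFin N) (λ t → unless (in₂ r s t) ((z t - μ) * e₃ r s t m)))
        ≈ tqRow m r s - tripleRow m r s - tripleRow′ m r s
      N*centredTripleRow m r s with r ≟ᶠ s
      ... | yes ≡.refl = begin
        ι N * (sq (z r - z r) * _)      ≈⟨ trans (*-congˡ (sq-self-* (z r) _)) (zeroʳ _) ⟩
        0#                              ≈⟨ trans (+-congʳ (-‿inverseʳ 0#)) (-‿inverseʳ 0#) ⟨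
        0# - 0# - 0#                    ≈⟨ +-cong (+-cong (∑∉-0 r r (λ t q → sq-self-* (z r) _)) (-‿cong (vanish (λ t → z r - z t))))
                                                  (-‿cong (vanish (λ t → z r - z t))) ⟨
        tqRow m r r - tripleRow m r r - tripleRow′ m r r ∎
        where
        vanish : ∀ (h : Fin N → Carrier) → ∑ (allFin N) (λ t → unless (in₂ r r t) (sq (z r - z r) * (h t * e₃ r r t m))) ≈ 0#
        vanish h = trans (∑-cong (allFin N) (λ t → trans (unless-cong (in₂ r r t) (sq-self-* (z r) _)) (unless-0# _))) (∑-0 (allFin N))
      ... | no r≢s = begin
        ι N * (D * ∑ (allFin N) V)
          ≈⟨ solve 3 (λ n d v → n :* (d :* v) := d :* (n :* v)) refl (ι N) D _ ⟩
        D * (ι N * ∑ (allFin N) V)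
          ≈⟨ *-congˡ (∑-*ˡ (allFin N) (ι N) V) ⟨
        D * ∑ (allFin N) (λ t → ι N * V t)
          ≈⟨ *-congˡ (∑-cong (allFin N) (λ t → trans (*-unless (in₂ r s t) _ (ι N)) (unless-cong (in₂ r s t) (N*centred t (e₃ r s t m))))) ⟩
        D * ∑ (allFin N) (λ t → unless (in₂ r s t) (∑ (allFin N) (λ q → (z t - z q) * e₃ r s t m)))
          ≈⟨ ∑-*ˡ (allFin N) D _ ⟨
        ∑ (allFin N) (λ t → D * unless (in₂ r s t) (∑ (allFin N) (λ q → (z t - z q) * e₃ r s t m)))
          ≈⟨ ∑-cong (allFin N) (deviation-row r≢s m) ⟩
        ∑ (allFin N) (λ t → T t - A t - A′ t)
          ≈⟨ trans (∑-- (allFin N) _ A′) (+-congʳ (∑-- (allFin N) T A)) ⟩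
        tqRow m r s - tripleRow m r s - tripleRow′ m r s ∎
        where
        D = sq (z r - z s)
        V T A A′ : Fin N → Carrier
        V t = unless (in₂ r s t) ((z t - μ) * e₃ r s t m)
        T t = ∑ (allFin N) (λ q → unless (in₂ r s t) (unless (in₃ r s t q) (D * ((z t - z q) * e₃ r s t m))))
        A t = unless (in₂ r s t) (D * ((z r - z t) * e₃ r s t m))
        A′ t = unless (in₂ r s t) (D * ((z s - z t) * e₃ r s t m))

      tripleRow′≈tripleRow : ∀ m r s → tripleRow′ m r s ≈ tripleRow m s r
      tripleRow′≈tripleRow m r s = ∑-cong (allFin N) λ t →
        trans (unless-cong (in₂ r s t) (*-cong (solve 2 (λ a b → (a :- b) :* (a :- b) := (b :- a) :* (b :- a)) refl (z r) (z s))
                                               (*-congˡ (esym-cong (zeroAt-cong t (zeroAt-comm s r z)) m))))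
              (reflexive (≡.cong (λ b → unless b (sq (z s - z r) * ((z s - z t) * e₃ s r t m))) (∨-comm (t ≐ r) (t ≐ s))))

      tqRow-0 : ∀ r s → tqRow 0 r s ≈ 0#
      tqRow-0 r s = ∑∉-antisym r s _ λ t q →
        solve 4 (λ D a b o → D :* ((b :- a) :* o) := :- (D :* ((a :- b) :* o))) refl (sq (z r - z s)) (z t) (z q) 1#

      unless-in₃-z∖₃ : ∀ r s t q x → unless (in₃ r s t q) (z∖₃ r s t q * x) ≈ unless (in₃ r s t q) (z q * x)
      unless-in₃-z∖₃ r s t q x with q ≐ r | q ≐ s | q ≐ t
      ... | true  | _     | _     = refl
      ... | false | true  | _     = refl
      ... | false | false | true  = refl
      ... | false | false | false = refl

      unless-e₃-suc : ∀ r s t q m (x : Carrier) →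
        unless (in₃ r s t q) (x * e₃ r s t (suc m))
        ≈ unless (in₃ r s t q) (x * esym (z∖₄ r s t q) (suc m) + z q * (x * esym (z∖₄ r s t q) m))
      unless-e₃-suc r s t q m x = begin
        unless b (x * e₃ r s t (suc m))
          ≈⟨ unless-cong b (trans (*-congˡ (esym-split (z∖₃ r s t) q m))
                                  (solve 4 (λ x e₁ y e₀ → x :* (e₁ :+ y :* e₀) := x :* e₁ :+ y :* (x :* e₀)) refl x e₁ (z∖₃ r s t q) e₀)) ⟩
        unless b (x * e₁ + z∖₃ r s t q * (x * e₀))          ≈⟨ unless-+ b _ _ ⟩
        unless b (x * e₁) + unless b (z∖₃ r s t q * (x * e₀)) ≈⟨ +-congˡ (unless-in₃-z∖₃ r s t q (x * e₀)) ⟩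
        unless b (x * e₁) + unless b (z q * (x * e₀))         ≈⟨ unless-+ b _ _ ⟨
        unless b (x * e₁ + z q * (x * e₀))                   ∎
        where
        b = in₃ r s t q
        e₁ = esym (z∖₄ r s t q) (suc m)
        e₀ = esym (z∖₄ r s t q) m

      -- Split e₃ at q: the first part is antisymmetric in t and q, the second symmetrises to −(z_t − z_q)² / 2.
      tqRow-suc : ∀ m r s → tqRow (suc m) r s ≈ - (φ ℚ.½ * quadRow m r s)
      tqRow-suc m r s = begin
        tqRow (suc m) r s
          ≈⟨ ∑∉-cong-unless r s (λ t q → trans (unless-cong (in₃ r s t q) (sym (*-assoc _ _ _)))
                                               (unless-e₃-suc r s t q m (D * (z t - z q)))) ⟩
        ∑∉ r s (λ t q → G₁ t q + G₂ t q)
          ≈⟨ ∑∉-+ r s G₁ G₂ ⟩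
        ∑∉ r s G₁ + ∑∉ r s G₂
          ≈⟨ +-cong (∑∉-antisym r s G₁ G₁-antisym) (∑∉-symmetrize r s G₂) ⟩
        0# + φ ℚ.½ * ∑∉ r s (λ t q → G₂ t q + G₂ q t)
          ≈⟨ +-identityˡ _ ⟩
        φ ℚ.½ * ∑∉ r s (λ t q → G₂ t q + G₂ q t)
          ≈⟨ *-congˡ (trans (∑∉-cong r s G₂-symmetrized) (∑∉-neg r s _)) ⟩
        φ ℚ.½ * - quadRow m r s
          ≈⟨ solve 2 (λ h x → h :* (:- x) := :- (h :* x)) refl (φ ℚ.½) (quadRow m r s) ⟩
        - (φ ℚ.½ * quadRow m r s) ∎
        where
        D = sq (z r - z s)
        e₄ : Fin N → Fin N → ℕ → Carrier
        e₄ t q = esym (z∖₄ r s t q)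
        e₄-sym : ∀ t q k → e₄ q t k ≈ e₄ t q k
        e₄-sym t q = esym-cong (zeroAt-comm t q (z∖₂ r s))
        G₁ G₂ : Fin N → Fin N → Carrier
        G₁ t q = D * (z t - z q) * e₄ t q (suc m)
        G₂ t q = z q * (D * (z t - z q) * e₄ t q m)
        G₁-antisym : ∀ t q → G₁ q t ≈ - G₁ t q
        G₁-antisym t q = trans (*-congˡ (e₄-sym t q (suc m)))
          (solve 4 (λ D a b e → D :* (b :- a) :* e := :- (D :* (a :- b) :* e)) refl D (z t) (z q) (e₄ t q (suc m)))
        G₂-symmetrized : ∀ t q → G₂ t q + G₂ q t ≈ - (D * (sq (z t - z q) * e₄ t q m))
        G₂-symmetrized t q = trans (+-congˡ (*-congˡ (*-congˡ (e₄-sym t q m))))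
          (solve 4 (λ D a b e → b :* (D :* (a :- b) :* e) :+ a :* (D :* (b :- a) :* e) := :- (D :* ((a :- b) :* (a :- b) :* e)))
                 refl D (z t) (z q) (e₄ t q m))

      ∑∑tqRow : ∀ m → ∑ (allFin N) (λ r → ∑ (allFin N) (tqRow m r)) ≈ - (φ ℚ.½ * quadSum m)
      ∑∑tqRow zero = begin
        ∑ (allFin N) (λ r → ∑ (allFin N) (tqRow 0 r))
          ≈⟨ trans (∑-cong (allFin N) λ r → trans (∑-cong (allFin N) (tqRow-0 r)) (∑-0 (allFin N))) (∑-0 (allFin N)) ⟩
        0#                                            ≈⟨ trans (-‿cong (zeroʳ _)) -0#≈0# ⟨
        - (φ ℚ.½ * 0#)                                ∎
      ∑∑tqRow (suc m) = begin
        ∑ (allFin N) (λ r → ∑ (allFin N) (tqRow (suc m) r))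
          ≈⟨ ∑-cong (allFin N) (λ r → trans (∑-cong (allFin N) (tqRow-suc m r)) (trans (∑-neg (allFin N) _) (-‿cong (∑-*ˡ (allFin N) _ _)))) ⟩
        ∑ (allFin N) (λ r → - (φ ℚ.½ * ∑ (allFin N) (quadRow m r)))
          ≈⟨ trans (∑-neg (allFin N) _) (-‿cong (∑-*ˡ (allFin N) _ _)) ⟩
        - (φ ℚ.½ * quadSum (suc m)) ∎

    N*centredTripleSum : ∀ m → ι N * centredTripleSum m ≈ - (𝟐 * tripleSum m + φ ℚ.½ * quadSum m)
    N*centredTripleSum m = begin
      ι N * centredTripleSum m
        ≈⟨ trans (∑-cong (allFin N) (λ r → ∑-*ˡ (allFin N) _ _)) (∑-*ˡ (allFin N) _ _) ⟨
      ∑ (allFin N) (λ r → ∑ (allFin N) (λ s → ι N * (sq (z r - z s) * ∑ (allFin N) (λ t → unless (in₂ r s t) ((z t - μ) * e₃ r s t m)))))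
        ≈⟨ ∑-cong (allFin N) (λ r → ∑-cong (allFin N) (N*centredTripleRow m r)) ⟩
      ∑ (allFin N) (λ r → ∑ (allFin N) (λ s → tqRow m r s - tripleRow m r s - tripleRow′ m r s))
        ≈⟨ ∑-cong (allFin N) (λ r → trans (∑-- (allFin N) _ _) (+-congʳ (∑-- (allFin N) _ _))) ⟩
      ∑ (allFin N) (λ r → ∑ (allFin N) (tqRow m r) - ∑ (allFin N) (tripleRow m r) - ∑ (allFin N) (tripleRow′ m r))
        ≈⟨ trans (∑-- (allFin N) _ _) (+-congʳ (∑-- (allFin N) _ _)) ⟩
      ∑ (allFin N) (λ r → ∑ (allFin N) (tqRow m r)) - tripleSum m - ∑ (allFin N) (λ r → ∑ (allFin N) (tripleRow′ m r))
        ≈⟨ +-cong (+-congʳ (∑∑tqRow m)) (-‿cong swapped) ⟩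
      - (φ ℚ.½ * quadSum m) - tripleSum m - tripleSum m
        ≈⟨ solve 3 (λ h q x → :- (h :* q) :- x :- x := :- (con (frac 2 1) :* x :+ h :* q)) refl (φ ℚ.½) (quadSum m) (tripleSum m) ⟩
      - (𝟐 * tripleSum m + φ ℚ.½ * quadSum m) ∎
      where
      swapped : ∑ (allFin N) (λ r → ∑ (allFin N) (tripleRow′ m r)) ≈ tripleSum m
      swapped = trans (∑-cong (allFin N) (λ r → ∑-cong (allFin N) (tripleRow′≈tripleRow m r)))
                      (∑-comm (allFin N) (allFin N) (λ r s → tripleRow m s r))

  -- The induction on n

  module Assembly {M : ℕ} (z : Fin (suc (suc M)) → Carrier) where

    N : ℕ
    N = suc (suc M)

    μ : Carrier
    μ = z̃ z

    mean : ι N * μ ≈ ∑ (allFin N) z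
    mean = trans (sym (*-assoc _ _ _)) (trans (*-congʳ (ι-inverse N)) (*-identityˡ _))

    open Quadruples z μ mean public

    V : Carrier
    V = ∑ (allFin N) (λ j → sq (z j - μ))

    pairSum-0 : pairSum 0 ≈ 𝟐 * ι N * V
    pairSum-0 = begin
      pairSum 0                                              ≈⟨ ∑-cong (allFin N) row ⟩
      ∑ (allFin N) (λ r → ι N * sq (z r - μ) + V)            ≈⟨ ∑-+ (allFin N) _ _ ⟩
      ∑ (allFin N) (λ r → ι N * sq (z r - μ)) + ∑ (allFin N) (λ _ → V)
                                                             ≈⟨ +-cong (∑-*ˡ (allFin N) (ι N) _) (∑-const N V) ⟩
      ι N * V + ι N * V                                      ≈⟨ solve 2 (λ n v → n :* v :+ n :* v := con (frac 2 1) :* n :* v) refl (ι N) V ⟩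
      𝟐 * ι N * V                                            ∎
      where
      deviations-sum : ∑ (allFin N) (λ s → z s - μ) ≈ 0#
      deviations-sum = trans (∑-- (allFin N) z (λ _ → μ))
        (trans (+-congˡ (-‿cong (∑-const N μ))) (trans (+-congʳ (sym mean)) (-‿inverseʳ _)))
      row : ∀ r → ∑ (allFin N) (λ s → sq (z r - z s) * 1#) ≈ ι N * sq (z r - μ) + V
      row r = begin
        ∑ (allFin N) (λ s → sq (z r - z s) * 1#)
          ≈⟨ ∑-cong (allFin N) (λ s → trans (*-identityʳ _)
               (solve 3 (λ a b c → (a :- b) :* (a :- b) := (a :- c) :* (a :- c) :+ (b :- c) :* (b :- c) :- con (frac 2 1) :* (a :- c) :* (b :- c))
                      refl (z r) (z s) μ)) ⟩
        ∑ (allFin N) (λ s → sq (z r - μ) + sq (z s - μ) - 𝟐 * (z r - μ) * (z s - μ))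
          ≈⟨ trans (∑-- (allFin N) _ _) (+-cong (∑-+ (allFin N) _ _) (-‿cong (∑-*ˡ (allFin N) _ _))) ⟩
        (∑ (allFin N) (λ s → sq (z r - μ)) + V) - 𝟐 * (z r - μ) * ∑ (allFin N) (λ s → z s - μ)
          ≈⟨ +-cong (+-congʳ (∑-const N _)) (-‿cong (trans (*-congˡ deviations-sum) (zeroʳ _))) ⟩
        (ι N * sq (z r - μ) + V) - 0#
          ≈⟨ trans (+-congˡ -0#≈0#) (+-identityʳ _) ⟩
        ι N * sq (z r - μ) + V ∎

    B : ℕ → Carrier
    B j = φ (frac 1 (2 ℕ.* N ℕ.* N)) * tripleSum j + φ (frac 1 (8 ℕ.* N ℕ.* N)) * quadSum j

    centredTripleSum≈B : ∀ j → centredTripleSum j ≈ - (ι (4 ℕ.* N) * B j)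
    centredTripleSum≈B j = ι-cancelˡ N (begin
      ι N * centredTripleSum j
        ≈⟨ N*centredTripleSum j ⟩
      - (𝟐 * tripleSum j + φ ℚ.½ * quadSum j)
        ≈⟨ -‿cong (+-cong (*-congʳ (coefficient 2 2 1 (N*4N≡2*2NN N)))
                          (*-congʳ (coefficient 8 1 2 (N*4N*2≡8NN N)))) ⟨
      - (ι N * (ι (4 ℕ.* N) * k₁) * tripleSum j + ι N * (ι (4 ℕ.* N) * k₂) * quadSum j)
        ≈⟨ solve 6 (λ n f k₁ x k₂ y → :- (n :* (f :* k₁) :* x :+ n :* (f :* k₂) :* y) := n :* (:- (f :* (k₁ :* x :+ k₂ :* y))))
                 refl (ι N) (ι (4 ℕ.* N)) k₁ (tripleSum j) k₂ (quadSum j) ⟩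
      ι N * - (ι (4 ℕ.* N) * B j) ∎)
      where
      N*4N≡2*2NN : ∀ N → N ℕ.* (4 ℕ.* N ℕ.* 1) ℕ.* 1 ≡ 2 ℕ.* (2 ℕ.* N ℕ.* N)
      N*4N≡2*2NN = solve-∀
      N*4N*2≡8NN : ∀ N → N ℕ.* (4 ℕ.* N ℕ.* 1) ℕ.* 2 ≡ 1 ℕ.* (8 ℕ.* N ℕ.* N)
      N*4N*2≡8NN = solve-∀
      k₁ = φ (frac 1 (2 ℕ.* N ℕ.* N))
      k₂ = φ (frac 1 (8 ℕ.* N ℕ.* N))
      coefficient : ∀ a b d .{{_ : NonZero (a ℕ.* N ℕ.* N)}} .{{_ : NonZero d}} →
                    N ℕ.* (4 ℕ.* N ℕ.* 1) ℕ.* d ≡ b ℕ.* (a ℕ.* N ℕ.* N) →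
                    ι N * (ι (4 ℕ.* N) * φ (frac 1 (a ℕ.* N ℕ.* N))) ≈ φ (frac b d)
      coefficient a b d eq = begin
        ι N * (ι (4 ℕ.* N) * φ (frac 1 (a ℕ.* N ℕ.* N)))    ≈⟨ *-congˡ (ι-*-φ-frac (4 ℕ.* N) 1 (a ℕ.* N ℕ.* N)) ⟩
        ι N * φ (frac (4 ℕ.* N ℕ.* 1) (a ℕ.* N ℕ.* N))       ≈⟨ ι-*-φ-frac N (4 ℕ.* N ℕ.* 1) (a ℕ.* N ℕ.* N) ⟩
        φ (frac (N ℕ.* (4 ℕ.* N ℕ.* 1)) (a ℕ.* N ℕ.* N))     ≈⟨ φ-frac-cong _ (a ℕ.* N ℕ.* N) b d eq ⟩
        φ (frac b d)                                         ∎

    den : ℕ → ℕ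
    den j = (3 ℕ.+ j) ℕ.* (2 ℕ.+ j) ℕ.* (1 ℕ.+ j) ℕ.* (N C (3 ℕ.+ j))

    den≢0 : ∀ {j} → suc j ≤ M → NonZero (den j)
    den≢0 {j} j<M = ℕ.m*n≢0 ((3 ℕ.+ j) ℕ.* (2 ℕ.+ j) ℕ.* (1 ℕ.+ j)) (N C (3 ℕ.+ j))
                      {{_}} {{ℕ.>-nonZero (nCk>0 (s≤s (s≤s j<M)))}}

    G : ℕ → Carrier
    G p = ∑< p (λ j → pow μ (p ℕ.∸ suc j) * (φ (frac 1 (den j)) * B j))

    G-suc : ∀ p → G (suc p) ≈ μ * G p + φ (frac 1 (den p)) * B p
    G-suc p = ∑<-pow-suc p μ (λ j → φ (frac 1 (den j)) * B j)

    κ : Carrier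
    κ = ι (4 ℕ.* N ℕ.* N ℕ.* suc M)

    private
      binomial-step : ∀ m → (ι N - ι m - 𝟐) * ι (M C m) ≈ ι (suc m) * ι (M C suc m)
      binomial-step m = trans (*-congʳ N-m-2≈M-m) (ι-binomial-step M m)
        where
        N-m-2≈M-m : ι N - ι m - 𝟐 ≈ ι M - ι m
        N-m-2≈M-m = trans (+-congʳ (+-congʳ (trans (ι-suc (suc M)) (+-congˡ (ι-suc M)))))
          (solve 2 (λ M m → con ℚ.1ℚ :+ (con ℚ.1ℚ :+ M) :- m :- con (frac 2 1) := M :- m) refl (ι M) (ι m))

      κ-den : ∀ m → (m<M : suc m ≤ M) →
              ι (suc m) * ι (M C suc m) * κ * φ (frac 1 (den m)) ≈ ι (4 ℕ.* N)
      κ-den m m<M = begin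
        ι (suc m) * ι (M C suc m) * κ * φ (frac 1 (den m))
          ≈⟨ *-congʳ (trans (ι-* (suc m ℕ.* (M C suc m)) (4 ℕ.* N ℕ.* N ℕ.* suc M)) (*-congʳ (ι-* (suc m) (M C suc m)))) ⟨
        ι (suc m ℕ.* (M C suc m) ℕ.* (4 ℕ.* N ℕ.* N ℕ.* suc M)) * φ (frac 1 (den m))
          ≈⟨ ι-*-φ-frac (suc m ℕ.* C₁ ℕ.* (4 ℕ.* N ℕ.* N ℕ.* suc M)) 1 (den m) ⟩
        φ (frac (suc m ℕ.* (M C suc m) ℕ.* (4 ℕ.* N ℕ.* N ℕ.* suc M) ℕ.* 1) (den m))
          ≈⟨ φ-frac-cong (suc m ℕ.* C₁ ℕ.* (4 ℕ.* N ℕ.* N ℕ.* suc M) ℕ.* 1) (den m) (4 ℕ.* N) 1 cross ⟩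
        φ (frac (4 ℕ.* N) 1)
          ≈⟨ φ-frac-1 (4 ℕ.* N) ⟩
        ι (4 ℕ.* N) ∎
        where
        instance
          den-nonZero : NonZero (den m)
          den-nonZero = den≢0 m<M
        C₁ = M C suc m
        C₃ = N C (3 ℕ.+ m)
        reassocˡ : ∀ m C N M₁ → suc m ℕ.* C ℕ.* (4 ℕ.* N ℕ.* N ℕ.* M₁) ℕ.* 1 ℕ.* 1 ≡ 4 ℕ.* N ℕ.* suc m ℕ.* (N ℕ.* M₁ ℕ.* C)
        reassocˡ = solve-∀
        reassocʳ : ∀ m C N → 4 ℕ.* N ℕ.* suc m ℕ.* ((3 ℕ.+ m) ℕ.* (2 ℕ.+ m) ℕ.* C)
                             ≡ 4 ℕ.* N ℕ.* ((3 ℕ.+ m) ℕ.* (2 ℕ.+ m) ℕ.* (1 ℕ.+ m) ℕ.* C)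
        reassocʳ = solve-∀
        cross : suc m ℕ.* C₁ ℕ.* (4 ℕ.* N ℕ.* N ℕ.* suc M) ℕ.* 1 ℕ.* 1 ≡ 4 ℕ.* N ℕ.* den m
        cross = ≡.trans (reassocˡ m C₁ N (suc M))
               (≡.trans (≡.cong (4 ℕ.* N ℕ.* suc m ℕ.*_) (≡.sym ([k+2]*[k+1]*[n+2]C[k+2]≡[n+2]*[n+1]*nCk M (suc m))))
                        (reassocʳ m C₃ N))

    pairSum-closed : ∀ m → m ≤ M → pairSum m ≈ ι (M C m) * (pow μ m * pairSum 0 - κ * G m)
    pairSum-closed zero _ = sym (begin
      ι 1 * (1# * pairSum 0 - κ * 0#)   ≈⟨ trans (*-congʳ ι-1) (*-identityˡ _) ⟩
      1# * pairSum 0 - κ * 0#           ≈⟨ +-cong (*-identityˡ _) (trans (-‿cong (zeroʳ κ)) -0#≈0#) ⟩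
      pairSum 0 + 0#                    ≈⟨ +-identityʳ _ ⟩
      pairSum 0                         ∎)
    pairSum-closed (suc m) m<M = ι-cancelˡ (suc m) (begin
      ι (suc m) * pairSum (suc m)
        ≈⟨ solve 2 (λ a b → a := a :- b :+ b) refl _ (K * pairSum m) ⟩
      ι (suc m) * pairSum (suc m) - K * pairSum m + K * pairSum m
        ≈⟨ +-cong (trans (sym (centredTripleSum-pairSum m)) (centredTripleSum≈B m)) (*-congˡ (pairSum-closed m (ℕ.<⇒≤ m<M))) ⟩
      - (ι (4 ℕ.* N) * B m) + K * (ι (M C m) * P)
        ≈⟨ +-congˡ (solve 4 (λ c a d p → c :* a :* (d :* p) := c :* (a :* d) :* p) refl μ (ι N - ι m - 𝟐) (ι (M C m)) P) ⟩
      - (ι (4 ℕ.* N) * B m) + μ * ((ι N - ι m - 𝟐) * ι (M C m)) * P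
        ≈⟨ +-cong (-‿cong (*-congʳ (sym (κ-den m m<M)))) (*-congʳ (*-congˡ (binomial-step m))) ⟩
      - (X * κ * d * B m) + μ * X * P
        ≈⟨ solve 8 (λ x k d b c p t g → :- (x :* k :* d :* b) :+ c :* x :* (p :* t :- k :* g)
                                        := x :* (c :* p :* t :- k :* (c :* g :+ d :* b)))
                 refl X κ d (B m) μ (pow μ m) (pairSum 0) (G m) ⟩
      X * (μ * pow μ m * pairSum 0 - κ * (μ * G m + d * B m))
        ≈⟨ *-congˡ (+-congˡ (-‿cong (*-congˡ (sym (G-suc m))))) ⟩
      X * (pow μ (suc m) * pairSum 0 - κ * G (suc m))
        ≈⟨ *-assoc _ _ _ ⟩
      ι (suc m) * (ι (M C suc m) * (pow μ (suc m) * pairSum 0 - κ * G (suc m))) ∎)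
      where
      K = μ * (ι N - ι m - 𝟐)
      P = pow μ m * pairSum 0 - κ * G m
      X = ι (suc m) * ι (M C suc m)
      d = φ (frac 1 (den m))

    Ê : ℕ → Carrier
    Ê k = φ (frac 1 (N C k)) * esym z k

    Ê-step : ∀ m → (m<M : suc m ≤ suc M) →
             Ê (2 ℕ.+ m) - μ * Ê (suc m)
             ≈ - (φ (frac 1 (2 ℕ.* N ℕ.* ((2 ℕ.+ m) ℕ.* (N C (2 ℕ.+ m))))) * pairSum m)
    Ê-step m m<M = sym (begin
      - (u * pairSum m)
        ≈⟨ -‿cong (*-congˡ (pairSum-esym m)) ⟩
      - (u * (𝟐 * ((ι N - ι (suc m)) * S * e₁ - ι (2 ℕ.+ m) * ι N * e₂)))
        ≈⟨ -‿cong (*-congˡ (*-congˡ (+-congʳ (*-congʳ (*-congˡ (sym mean)))))) ⟩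
      - (u * (𝟐 * ((ι N - ι (suc m)) * (ι N * μ) * e₁ - ι (2 ℕ.+ m) * ι N * e₂)))
        ≈⟨ solve 8 (λ u t n a c e₁ b e₂ → :- (u :* (t :* ((n :- a) :* (n :* c) :* e₁ :- b :* n :* e₂)))
                                          := (b :* (t :* n :* u)) :* e₂ :- c :* (((t :* n :* u) :* (n :- a)) :* e₁))
                 refl u 𝟐 (ι N) (ι (suc m)) μ e₁ (ι (2 ℕ.+ m)) e₂ ⟩
      (ι (2 ℕ.+ m) * (𝟐 * ι N * u)) * e₂ - μ * (((𝟐 * ι N * u) * (ι N - ι (suc m))) * e₁)
        ≈⟨ +-cong (*-congʳ (trans (*-congˡ 2Nu) (ι-*-φ-frac-cancel (2 ℕ.+ m) (N C (2 ℕ.+ m)) {{_}} {{b≢0}})))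
                  (-‿cong (*-congˡ (*-congʳ (trans (*-congʳ 2Nu) (φ-frac-binomial-step N (suc m) (s≤s m<M)))))) ⟩
      Ê (2 ℕ.+ m) - μ * Ê (suc m) ∎)
      where
      e₁ = esym z (suc m)
      e₂ = esym z (2 ℕ.+ m)
      D = (2 ℕ.+ m) ℕ.* (N C (2 ℕ.+ m))
      b≢0 : NonZero (N C (2 ℕ.+ m))
      b≢0 = ℕ.>-nonZero (nCk>0 (s≤s m<M))
      u = φ (frac 1 (2 ℕ.* N ℕ.* D))
      2Nu : 𝟐 * ι N * u ≈ φ (frac 1 D)
      2Nu = trans (*-congʳ (trans (*-congʳ (φ-frac-1 2)) (sym (ι-* 2 N))))
                  (ι-*-φ-frac-cancel (2 ℕ.* N) D {{_}} {{ℕ.m*n≢0 (2 ℕ.+ m) _ {{_}} {{b≢0}}}})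

    Lhs : ℕ → Carrier
    Lhs p = Ê (2 ℕ.+ p) - pow μ (2 ℕ.+ p) + φ (frac ((2 ℕ.+ p) ℕ.* (1 ℕ.+ p)) (2 ℕ.* N ℕ.* suc M)) * (V * pow μ p)

    lhs≈Lhs : ∀ p → φ (frac 1 (N C (2 ℕ.+ p))) * E z ⊤ (ℤ.+ (2 ℕ.+ p)) - pow μ (2 ℕ.+ p)
                    + φ (frac ((2 ℕ.+ p) ℕ.* (1 ℕ.+ p)) (2 ℕ.* N ℕ.* suc M)) * ∑ (allFin N) (λ j → sq (z j - μ) * pow μ p)
                    ≈ Lhs p
    lhs≈Lhs p = +-cong (+-congʳ (*-congˡ (trans (E-esym z ⊤ (2 ℕ.+ p)) (esym-cong (mask⊤ z) (2 ℕ.+ p)))))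
                       (*-congˡ (trans (∑-cong (allFin N) (λ j → *-comm _ _)) (trans (∑-*ˡ (allFin N) _ _) (*-comm _ _))))

    private
      Ê-recurrence : ∀ m → suc m ≤ suc M →
        Ê (2 ℕ.+ m) ≈ μ * Ê (suc m) - φ (frac 1 (2 ℕ.* N ℕ.* ((2 ℕ.+ m) ℕ.* (N C (2 ℕ.+ m))))) * pairSum m
      Ê-recurrence m m<M = trans (solve 2 (λ x y → x := (x :- y) :+ y) refl (Ê (2 ℕ.+ m)) (μ * Ê (suc m)))
                                 (trans (+-congʳ (Ê-step m m<M)) (+-comm _ _))

      Ê-1 : Ê 1 ≈ μ
      Ê-1 = *-cong (reflexive (≡.cong (λ k → φ (frac 1 k)) (nC1≡n N)))
                   (trans (sym (trans (*-congʳ ι-1) (*-identityˡ _))) (trans (sym (∑-*-esym-zeroAt z 0)) (∑-cong (allFin N) (λ j → *-identityʳ (z j)))))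

    Lhs-0 : Lhs 0 ≈ 0#
    Lhs-0 = begin
      Lhs 0
        ≈⟨ +-cong (+-congʳ (Ê-recurrence 0 (s≤s z≤n))) (*-congˡ (*-identityʳ V)) ⟩
      μ * Ê 1 - u * pairSum 0 - μ * (μ * 1#) + φ (frac 2 D₀) * V
        ≈⟨ +-congʳ (+-cong (+-cong (*-congˡ Ê-1) (-‿cong (*-congˡ pairSum-0))) (-‿cong (*-congˡ (*-identityʳ μ)))) ⟩
      μ * μ - u * (𝟐 * ι N * V) - μ * μ + φ (frac 2 D₀) * V
        ≈⟨ solve 6 (λ c u t n v w → c :* c :- u :* (t :* n :* v) :- c :* c :+ w :* v := (w :- t :* n :* u) :* v)
                 refl μ u 𝟐 (ι N) V (φ (frac 2 D₀)) ⟩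
      (φ (frac 2 D₀) - 𝟐 * ι N * u) * V
        ≈⟨ *-congʳ (+-congˡ (-‿cong 2Nu)) ⟩
      (φ (frac 2 D₀) - φ (frac 2 D₀)) * V
        ≈⟨ trans (*-congʳ (-‿inverseʳ _)) (zeroˡ V) ⟩
      0# ∎
      where
      D₀ = 2 ℕ.* N ℕ.* suc M
      2C[N,2]≡N*[N-1] : 2 ℕ.* (N C 2) ≡ N ℕ.* suc M
      2C[N,2]≡N*[N-1] = ≡.trans ([k+1]*[n+1]C[k+1]≡[n+1]*nCk (suc M) 1) (≡.cong (N ℕ.*_) (nC1≡n (suc M)))
      instance
        2C[N,2]≢0 : NonZero (2 ℕ.* (N C 2))
        2C[N,2]≢0 = ℕ.m*n≢0 2 (N C 2) {{_}} {{ℕ.>-nonZero (nCk>0 {N} {2} (s≤s (s≤s z≤n)))}}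
      u = φ (frac 1 (2 ℕ.* N ℕ.* (2 ℕ.* (N C 2))))
      2Nu : 𝟐 * ι N * u ≈ φ (frac 2 D₀)
      2Nu = begin
        𝟐 * ι N * u                        ≈⟨ *-congʳ (trans (*-congʳ (φ-frac-1 2)) (sym (ι-* 2 N))) ⟩
        ι (2 ℕ.* N) * u                    ≈⟨ ι-*-φ-frac-cancel (2 ℕ.* N) (2 ℕ.* (N C 2)) ⟩
        φ (frac 1 (2 ℕ.* (N C 2)))
          ≈⟨ φ-frac-cong 1 (2 ℕ.* (N C 2)) 2 D₀
               (≡.trans (ℕ.*-identityˡ D₀) (≡.trans (ℕ.*-assoc 2 N (suc M)) (≡.cong (2 ℕ.*_) (≡.sym 2C[N,2]≡N*[N-1])))) ⟩
        φ (frac 2 D₀)                      ∎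

    private
      variance-weight-suc : ∀ p →
        φ (frac ((3 ℕ.+ p) ℕ.* (2 ℕ.+ p)) (2 ℕ.* N ℕ.* suc M))
        ≈ φ (frac ((2 ℕ.+ p) ℕ.* (1 ℕ.+ p)) (2 ℕ.* N ℕ.* suc M)) + φ (frac (2 ℕ.* (2 ℕ.+ p)) (2 ℕ.* N ℕ.* suc M))
      variance-weight-suc p = trans (reflexive (≡.cong (λ k → φ (frac k (2 ℕ.* N ℕ.* suc M))) (numerators p)))
                                    (sym (φ-frac-+ ((2 ℕ.+ p) ℕ.* (1 ℕ.+ p)) (2 ℕ.* (2 ℕ.+ p)) (2 ℕ.* N ℕ.* suc M)))
        where
        numerators : ∀ p → (3 ℕ.+ p) ℕ.* (2 ℕ.+ p) ≡ (2 ℕ.+ p) ℕ.* (1 ℕ.+ p) ℕ.+ 2 ℕ.* (2 ℕ.+ p)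
        numerators = solve-∀

      pairSum-weight : ∀ p → (p<M : suc p ≤ M) →
        φ (frac 1 (2 ℕ.* N ℕ.* ((3 ℕ.+ p) ℕ.* (N C (3 ℕ.+ p))))) * ι (M C suc p) ≈ φ (frac (2 ℕ.+ p) (2 ℕ.* N ℕ.* N ℕ.* suc M))
      pairSum-weight p p<M =
        trans (*-comm _ _) (trans (ι-*-φ-frac (M C suc p) 1 D) (φ-frac-cong _ D (2 ℕ.+ p) (2 ℕ.* N ℕ.* N ℕ.* suc M) cross))
        where
        D = 2 ℕ.* N ℕ.* ((3 ℕ.+ p) ℕ.* (N C (3 ℕ.+ p)))
        instance
          D≢0 : NonZero D
          D≢0 = ℕ.m*n≢0 (2 ℕ.* N) ((3 ℕ.+ p) ℕ.* (N C (3 ℕ.+ p)))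
                  {{_}} {{ℕ.m*n≢0 (3 ℕ.+ p) (N C (3 ℕ.+ p)) {{_}} {{ℕ.>-nonZero (nCk>0 {N} {3 ℕ.+ p} (s≤s (s≤s p<M)))}}}}
        reassocˡ : ∀ C N M₁ → C ℕ.* 1 ℕ.* (2 ℕ.* N ℕ.* N ℕ.* M₁) ≡ 2 ℕ.* N ℕ.* (N ℕ.* M₁ ℕ.* C)
        reassocˡ = solve-∀
        reassocʳ : ∀ p C N → 2 ℕ.* N ℕ.* ((3 ℕ.+ p) ℕ.* (2 ℕ.+ p) ℕ.* C) ≡ (2 ℕ.+ p) ℕ.* (2 ℕ.* N ℕ.* ((3 ℕ.+ p) ℕ.* C))
        reassocʳ = solve-∀
        cross : (M C suc p) ℕ.* 1 ℕ.* (2 ℕ.* N ℕ.* N ℕ.* suc M) ≡ (2 ℕ.+ p) ℕ.* D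
        cross = ≡.trans (reassocˡ (M C suc p) N (suc M))
               (≡.trans (≡.cong (2 ℕ.* N ℕ.*_) (≡.sym ([k+2]*[k+1]*[n+2]C[k+2]≡[n+2]*[n+1]*nCk M (suc p))))
                        (reassocʳ p (N C (3 ℕ.+ p)) N))

      pairSum-weight-*-2N : ∀ p → φ (frac (2 ℕ.+ p) (2 ℕ.* N ℕ.* N ℕ.* suc M)) * 𝟐 * ι N ≈ φ (frac (2 ℕ.* (2 ℕ.+ p)) (2 ℕ.* N ℕ.* suc M))
      pairSum-weight-*-2N p = begin
        φ (frac (2 ℕ.+ p) D₁) * 𝟐 * ι N               ≈⟨ *-congʳ (*-congˡ (φ-frac-1 2)) ⟩
        φ (frac (2 ℕ.+ p) D₁) * ι 2 * ι N             ≈⟨ trans (*-comm _ _) (*-congˡ (*-comm _ _)) ⟩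
        ι N * (ι 2 * φ (frac (2 ℕ.+ p) D₁))           ≈⟨ trans (*-congˡ (ι-*-φ-frac 2 (2 ℕ.+ p) D₁)) (ι-*-φ-frac N (2 ℕ.* (2 ℕ.+ p)) D₁) ⟩
        φ (frac (N ℕ.* (2 ℕ.* (2 ℕ.+ p))) D₁)         ≈⟨ φ-frac-cong _ D₁ (2 ℕ.* (2 ℕ.+ p)) (2 ℕ.* N ℕ.* suc M) (cross N (suc M) p) ⟩
        φ (frac (2 ℕ.* (2 ℕ.+ p)) (2 ℕ.* N ℕ.* suc M)) ∎
        where
        D₁ = 2 ℕ.* N ℕ.* N ℕ.* suc M
        cross : ∀ N M₁ p → N ℕ.* (2 ℕ.* (2 ℕ.+ p)) ℕ.* (2 ℕ.* N ℕ.* M₁) ≡ 2 ℕ.* (2 ℕ.+ p) ℕ.* (2 ℕ.* N ℕ.* N ℕ.* M₁)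
        cross = solve-∀

      pairSum-weight-*-κ : ∀ p → φ (frac (2 ℕ.+ p) (2 ℕ.* N ℕ.* N ℕ.* suc M)) * κ ≈ ι (2 ℕ.* (2 ℕ.+ p))
      pairSum-weight-*-κ p = begin
        φ (frac (2 ℕ.+ p) D₁) * κ                           ≈⟨ *-comm _ _ ⟩
        κ * φ (frac (2 ℕ.+ p) D₁)                           ≈⟨ ι-*-φ-frac (4 ℕ.* N ℕ.* N ℕ.* suc M) (2 ℕ.+ p) D₁ ⟩
        φ (frac (4 ℕ.* N ℕ.* N ℕ.* suc M ℕ.* (2 ℕ.+ p)) D₁) ≈⟨ φ-frac-cong _ D₁ (2 ℕ.* (2 ℕ.+ p)) 1 (cross N (suc M) p) ⟩
        φ (frac (2 ℕ.* (2 ℕ.+ p)) 1)                       ≈⟨ φ-frac-1 (2 ℕ.* (2 ℕ.+ p)) ⟩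
        ι (2 ℕ.* (2 ℕ.+ p))                                ∎
        where
        D₁ = 2 ℕ.* N ℕ.* N ℕ.* suc M
        cross : ∀ N M₁ p → 4 ℕ.* N ℕ.* N ℕ.* M₁ ℕ.* (2 ℕ.+ p) ℕ.* 1 ≡ 2 ℕ.* (2 ℕ.+ p) ℕ.* (2 ℕ.* N ℕ.* N ℕ.* M₁)
        cross = solve-∀

    Lhs-suc : ∀ p → suc p ≤ M → Lhs (suc p) ≈ μ * Lhs p + ι (2 ℕ.* (2 ℕ.+ p)) * G (suc p)
    Lhs-suc p p<M = begin
      Lhs (suc p)
        ≈⟨ +-cong (+-congʳ (Ê-recurrence (suc p) (s≤s p<M))) (*-congʳ (variance-weight-suc p)) ⟩
      μ * Ê (2 ℕ.+ p) - u * pairSum (suc p) - μ * pow μ (2 ℕ.+ p) + (v + w) * (V * (μ * pow μ p))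
        ≈⟨ +-congʳ (+-congʳ (+-congˡ (-‿cong (*-congˡ (trans (pairSum-closed (suc p) p<M) (*-congˡ (+-congʳ (*-congˡ pairSum-0)))))))) ⟩
      μ * Ê (2 ℕ.+ p) - u * (ιC * (μ * pow μ p * (𝟐 * ι N * V) - κ * G (suc p))) - μ * pow μ (2 ℕ.+ p) + (v + w) * (V * (μ * pow μ p))
        ≈⟨ solve 12 (λ c ê u i p t n v k g v′ w →
                     c :* ê :- u :* (i :* (c :* p :* (t :* n :* v) :- k :* g)) :- c :* (c :* (c :* p)) :+ (v′ :+ w) :* (v :* (c :* p))
                     := c :* (ê :- c :* (c :* p) :+ v′ :* (v :* p)) :+ (u :* i) :* k :* g :+ (w :- (u :* i) :* t :* n) :* (v :* (c :* p)))
                 refl μ (Ê (2 ℕ.+ p)) u ιC (pow μ p) 𝟐 (ι N) V κ (G (suc p)) v w ⟩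
      μ * Lhs p + (u * ιC) * κ * G (suc p) + (w - (u * ιC) * 𝟐 * ι N) * (V * (μ * pow μ p))
        ≈⟨ +-cong (+-congˡ (*-congʳ (trans (*-congʳ (pairSum-weight p p<M)) (pairSum-weight-*-κ p))))
                  (trans (*-congʳ (trans (+-congˡ (-‿cong (trans (*-congʳ (*-congʳ (pairSum-weight p p<M))) (pairSum-weight-*-2N p))))
                                         (-‿inverseʳ w)))
                         (zeroˡ _)) ⟩
      μ * Lhs p + ι (2 ℕ.* (2 ℕ.+ p)) * G (suc p) + 0#
        ≈⟨ +-identityʳ _ ⟩
      μ * Lhs p + ι (2 ℕ.* (2 ℕ.+ p)) * G (suc p) ∎
      where
      u = φ (frac 1 (2 ℕ.* N ℕ.* ((3 ℕ.+ p) ℕ.* (N C (3 ℕ.+ p)))))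
      ιC = ι (M C suc p)
      v = φ (frac ((2 ℕ.+ p) ℕ.* (1 ℕ.+ p)) (2 ℕ.* N ℕ.* suc M))
      w = φ (frac (2 ℕ.* (2 ℕ.+ p)) (2 ℕ.* N ℕ.* suc M))

    Rhs : ℕ → Carrier
    Rhs p = ∑< p (λ j → pow μ (p ℕ.∸ suc j) * (φ (h̃ (3 ℕ.+ j) (2 ℕ.+ p) N) * B j))

    private
      ι-*-φ-frac-1 : ∀ a d .{{_ : NonZero d}} → φ (frac a d) ≈ ι a * φ (frac 1 d)
      ι-*-φ-frac-1 a d = sym (trans (ι-*-φ-frac a 1 d) (reflexive (≡.cong (λ k → φ (frac k d)) (ℕ.*-identityʳ a))))

      h̃-suc : ∀ {j p} → j < p → p ≤ M →
              φ (h̃ (3 ℕ.+ j) (3 ℕ.+ p) N) ≈ φ (h̃ (3 ℕ.+ j) (2 ℕ.+ p) N) + ι (2 ℕ.* (2 ℕ.+ p)) * φ (frac 1 (den j))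
      h̃-suc {j} j<p p≤M with ℕ.m≤n⇒∃[o]m+o≡n j<p
      ... | d , ≡.refl = begin
        φ (h̃ (3 ℕ.+ j) (3 ℕ.+ p) N)
          ≡⟨ ≡.cong (λ k → φ (frac k (den j))) (h̃-numerator-suc j d) ⟩
        φ (frac (a ℕ.+ 2 ℕ.* (2 ℕ.+ p)) (den j))
          ≈⟨ φ-frac-+ a (2 ℕ.* (2 ℕ.+ p)) (den j) ⟨
        φ (frac a (den j)) + φ (frac (2 ℕ.* (2 ℕ.+ p)) (den j))
          ≈⟨ +-congˡ (ι-*-φ-frac-1 (2 ℕ.* (2 ℕ.+ p)) (den j)) ⟩
        φ (h̃ (3 ℕ.+ j) (2 ℕ.+ p) N) + ι (2 ℕ.* (2 ℕ.+ p)) * φ (frac 1 (den j)) ∎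
        where
        p = suc (j ℕ.+ d)
        a = (2 ℕ.+ p ℕ.+ (3 ℕ.+ j) ℕ.∸ 2) ℕ.* (2 ℕ.+ p ℕ.∸ (3 ℕ.+ j) ℕ.+ 1)
        instance
          den≢0′ : NonZero (den j)
          den≢0′ = den≢0 (ℕ.≤-trans (s≤s (ℕ.m≤m+n j d)) p≤M)

      h̃-diag : ∀ p → suc p ≤ M → φ (h̃ (3 ℕ.+ p) (3 ℕ.+ p) N) ≈ ι (2 ℕ.* (2 ℕ.+ p)) * φ (frac 1 (den p))
      h̃-diag p p<M = trans (reflexive (≡.cong (λ k → φ (frac k (den p))) (h̃-numerator-diag p)))
                           (ι-*-φ-frac-1 (2 ℕ.* (2 ℕ.+ p)) (den p) {{den≢0 p<M}})

    Rhs-suc : ∀ p → suc p ≤ M → Rhs (suc p) ≈ μ * Rhs p + ι (2 ℕ.* (2 ℕ.+ p)) * G (suc p)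
    Rhs-suc p p<M = begin
      Rhs (suc p)
        ≈⟨ ∑<-pow-suc p μ (λ j → φ (h̃ (3 ℕ.+ j) (3 ℕ.+ p) N) * B j) ⟩
      μ * ∑< p (λ j → pow μ (p ℕ.∸ suc j) * (φ (h̃ (3 ℕ.+ j) (3 ℕ.+ p) N) * B j)) + φ (h̃ (3 ℕ.+ p) (3 ℕ.+ p) N) * B p
        ≈⟨ +-cong (*-congˡ (∑<-cong p λ j j<p → *-congˡ (*-congʳ (h̃-suc j<p (ℕ.<⇒≤ p<M)))))
                  (*-congʳ (h̃-diag p p<M)) ⟩
      μ * ∑< p (λ j → pow μ (p ℕ.∸ suc j) * ((φ (h̃ (3 ℕ.+ j) (2 ℕ.+ p) N) + T * φ (frac 1 (den j))) * B j))
        + T * φ (frac 1 (den p)) * B p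
        ≈⟨ +-congʳ (*-congˡ (∑<-cong p λ j _ → solve 5 (λ w h t d b → w :* ((h :+ t :* d) :* b) := w :* (h :* b) :+ t :* (w :* (d :* b)))
                                                        refl (pow μ (p ℕ.∸ suc j)) (φ (h̃ (3 ℕ.+ j) (2 ℕ.+ p) N)) T (φ (frac 1 (den j))) (B j))) ⟩
      μ * ∑< p (λ j → pow μ (p ℕ.∸ suc j) * (φ (h̃ (3 ℕ.+ j) (2 ℕ.+ p) N) * B j)
                     + T * (pow μ (p ℕ.∸ suc j) * (φ (frac 1 (den j)) * B j)))
        + T * φ (frac 1 (den p)) * B p
        ≈⟨ +-congʳ (*-congˡ (trans (∑<-+ p _ _) (+-congˡ (∑<-*ˡ p T _)))) ⟩
      μ * (Rhs p + T * G p) + T * φ (frac 1 (den p)) * B p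
        ≈⟨ trans (+-congˡ (*-assoc T _ _))
                 (solve 5 (λ c r t g x → c :* (r :+ t :* g) :+ t :* x := c :* r :+ t :* (c :* g :+ x))
                        refl μ (Rhs p) T (G p) (φ (frac 1 (den p)) * B p)) ⟩
      μ * Rhs p + T * (μ * G p + φ (frac 1 (den p)) * B p)
        ≈⟨ +-congˡ (*-congˡ (G-suc p)) ⟨
      μ * Rhs p + T * G (suc p) ∎
      where T = ι (2 ℕ.* (2 ℕ.+ p))

    Lhs≈Rhs : ∀ p → p ≤ M → Lhs p ≈ Rhs p
    Lhs≈Rhs zero    _   = Lhs-0
    Lhs≈Rhs (suc p) p<M = begin
      Lhs (suc p)                                    ≈⟨ Lhs-suc p p<M ⟩
      μ * Lhs p + ι (2 ℕ.* (2 ℕ.+ p)) * G (suc p)    ≈⟨ +-congʳ (*-congˡ (Lhs≈Rhs p (ℕ.<⇒≤ p<M))) ⟩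
      μ * Rhs p + ι (2 ℕ.* (2 ℕ.+ p)) * G (suc p)    ≈⟨ Rhs-suc p p<M ⟨
      Rhs (suc p)                                    ∎

    H : ℕ → ℕ → Carrier
    H p j = φ (h̃ (3 ℕ.+ j) (2 ℕ.+ p) N) * pow μ (p ℕ.∸ suc j)

    h̃E : ℕ → ℕ → Subset N → ℕ → Carrier
    h̃E n m A k = φ (h̃ k n N) * pow μ (n ℕ.∸ k) * E z A (ℤ.+ k ℤ.- ℤ.+ suc m)

    e₄′ : Fin N → Fin N → Fin N → Fin N → ℕ → Carrier
    e₄′ a b c d zero    = 0#
    e₄′ a b c d (suc m) = esym (z∖₄ a b c d) m

    private
      ∑h̃E₃ : ∀ p r s t → ∑ [ 2 ℕ.+ p ]∖[ 2 ] (h̃E (2 ℕ.+ p) 2 (removing (r ∷ s ∷ t ∷ [])))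
                         ≈ ∑< p (λ j → H p j * esym (z∖₃ r s t) j)
      ∑h̃E₃ p r s t = trans (∑-[2+p]∖[2] p (h̃E (2 ℕ.+ p) 2 (removing (r ∷ s ∷ t ∷ [])))) (∑<-cong p (λ j _ →
        *-congˡ (trans (E-esym z _ j) (esym-cong (mask-removing-reverse (r ∷ s ∷ t ∷ []) z) j))))

      ∑h̃E₄ : ∀ p a b c d → ∑ [ 2 ℕ.+ p ]∖[ 3 ] (h̃E (2 ℕ.+ p) 3 (removing (a ∷ b ∷ c ∷ d ∷ [])))
                           ≈ ∑< p (λ j → H p j * e₄′ a b c d j)
      ∑h̃E₄ p a b c d = trans (∑-[2+p]∖[3] p (h̃E (2 ℕ.+ p) 3 (removing (a ∷ b ∷ c ∷ d ∷ []))) (trans (*-congˡ (E≈e₄′ 0)) (zeroʳ _)))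
                              (∑<-cong p (λ j _ → *-congˡ (E≈e₄′ j)))
        where
        E≈e₄′ : ∀ j → E z (removing (a ∷ b ∷ c ∷ d ∷ [])) (ℤ.+ (3 ℕ.+ j) ℤ.- ℤ.+ 4) ≈ e₄′ a b c d j
        E≈e₄′ zero    = E-negative z _ 0
        E≈e₄′ (suc m) = trans (E-esym z _ m) (esym-cong (mask-removing-reverse (a ∷ b ∷ c ∷ d ∷ []) z) m)

      ∑≠3-summand : ∀ p r s t →
        (if not (r ≐ s ∨ r ≐ t ∨ s ≐ t)
         then sq (z r - z s) * (z r - z t) * ∑ [ 2 ℕ.+ p ]∖[ 2 ] (h̃E (2 ℕ.+ p) 2 (removing (r ∷ s ∷ t ∷ [])))
         else 0#)
        ≈ ∑< p (λ j → H p j * unless (t ≐ r ∨ t ≐ s) (sq (z r - z s) * ((z r - z t) * esym (z∖₃ r s t) j)))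
      ∑≠3-summand p r s t rewrite distinct₃-split r s t = begin
        _ ≈⟨ if-not-∨ (r ≐ s) in₂ _ ⟩
        unless (r ≐ s) (unless in₂ (D * (z r - z t) * _))
          ≈⟨ unless-≐ r s (λ { ≡.refl → trans (unless-cong in₂ (trans (*-congʳ (sq-self-* (z r) _)) (zeroˡ _))) (unless-0# _) }) ⟩
        unless in₂ (D * (z r - z t) * _)
          ≈⟨ unless-cong in₂ (*-congˡ (∑h̃E₃ p r s t)) ⟩
        unless in₂ (D * (z r - z t) * ∑< p (λ j → H p j * esym (z∖₃ r s t) j))
          ≈⟨ trans (unless-cong in₂ (*-∑< p (H p) _ _)) (unless-∑< in₂ p (H p) _) ⟩
        ∑< p (λ j → H p j * unless in₂ (D * (z r - z t) * esym (z∖₃ r s t) j))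
          ≈⟨ ∑<-cong p (λ j _ → *-congˡ (unless-cong in₂ (*-assoc _ _ _))) ⟩
        ∑< p (λ j → H p j * unless in₂ (D * ((z r - z t) * esym (z∖₃ r s t) j))) ∎
        where
        D = sq (z r - z s)
        in₂ = t ≐ r ∨ t ≐ s

      ∑≠4-summand : ∀ p a b c d →
        (if not (a ≐ b ∨ a ≐ c ∨ a ≐ d ∨ b ≐ c ∨ b ≐ d ∨ c ≐ d)
         then sq (z a - z b) * sq (z c - z d) * ∑ [ 2 ℕ.+ p ]∖[ 3 ] (h̃E (2 ℕ.+ p) 3 (removing (a ∷ b ∷ c ∷ d ∷ [])))
         else 0#)
        ≈ ∑< p (λ j → H p j * unless (c ≐ a ∨ c ≐ b) (unless ((d ≐ a ∨ d ≐ b) ∨ d ≐ c)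
                                  (sq (z a - z b) * (sq (z c - z d) * e₄′ a b c d j))))
      ∑≠4-summand p a b c d rewrite distinct₄-split a b c d = begin
        _ ≈⟨ if-not-∨ (a ≐ b) (in₂ ∨ in₃) _ ⟩
        unless (a ≐ b) (unless (in₂ ∨ in₃) (D * D′ * _))
          ≈⟨ unless-≐ a b (λ { ≡.refl → trans (unless-cong (in₂ ∨ in₃) (trans (*-congʳ (sq-self-* (z a) _)) (zeroˡ _))) (unless-0# _) }) ⟩
        unless (in₂ ∨ in₃) (D * D′ * _)
          ≈⟨ unless-∨ in₂ in₃ _ ⟩
        unless in₂ (unless in₃ (D * D′ * _))
          ≈⟨ unless-cong in₂ (unless-cong in₃ (*-congˡ (∑h̃E₄ p a b c d))) ⟩
        unless in₂ (unless in₃ (D * D′ * ∑< p (λ j → H p j * e₄′ a b c d j)))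
          ≈⟨ unless-cong in₂ (trans (unless-cong in₃ (*-∑< p (H p) _ _)) (unless-∑< in₃ p (H p) _)) ⟩
        unless in₂ (∑< p (λ j → H p j * unless in₃ (D * D′ * e₄′ a b c d j)))
          ≈⟨ unless-∑< in₂ p (H p) _ ⟩
        ∑< p (λ j → H p j * unless in₂ (unless in₃ (D * D′ * e₄′ a b c d j)))
          ≈⟨ ∑<-cong p (λ j _ → *-congˡ (unless-cong in₂ (unless-cong in₃ (*-assoc _ _ _)))) ⟩
        ∑< p (λ j → H p j * unless in₂ (unless in₃ (D * (D′ * e₄′ a b c d j)))) ∎
        where
        D = sq (z a - z b)
        D′ = sq (z c - z d)
        in₂ = c ≐ a ∨ c ≐ b
        in₃ = (d ≐ a ∨ d ≐ b) ∨ d ≐ c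

      ∑≠3-tripleSum : ∀ p →
        ∑≠3 z (λ r s t → sq (z r - z s) * (z r - z t) * ∑ [ 2 ℕ.+ p ]∖[ 2 ] (h̃E (2 ℕ.+ p) 2 (removing (r ∷ s ∷ t ∷ []))))
        ≈ ∑< p (λ j → H p j * tripleSum j)
      ∑≠3-tripleSum p = begin
        _ ≈⟨ ∑-cong (allFin N) (λ r → ∑-cong (allFin N) (λ s → ∑-cong (allFin N) (∑≠3-summand p r s))) ⟩
        ∑ (allFin N) (λ r → ∑ (allFin N) (λ s → ∑ (allFin N) (λ t → ∑< p (λ j → H p j * T r s t j))))
          ≈⟨ ∑-cong (allFin N) (λ r → trans (∑-cong (allFin N) (λ s → ∑-∑<-*ˡ (allFin N) p (H p) (T r s))) (∑-∑<-*ˡ (allFin N) p (H p) _)) ⟩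
        ∑ (allFin N) (λ r → ∑< p (λ j → H p j * ∑ (allFin N) (λ s → ∑ (allFin N) (λ t → T r s t j))))
          ≈⟨ ∑-∑<-*ˡ (allFin N) p (H p) _ ⟩
        ∑< p (λ j → H p j * tripleSum j) ∎
        where
        T : Fin N → Fin N → Fin N → ℕ → Carrier
        T r s t j = unless (t ≐ r ∨ t ≐ s) (sq (z r - z s) * ((z r - z t) * esym (z∖₃ r s t) j))

      ∑≠4-quadSum : ∀ p →
        ∑≠4 z (λ a b c d → sq (z a - z b) * sq (z c - z d) * ∑ [ 2 ℕ.+ p ]∖[ 3 ] (h̃E (2 ℕ.+ p) 3 (removing (a ∷ b ∷ c ∷ d ∷ []))))
        ≈ ∑< p (λ j → H p j * quadSum j)
      ∑≠4-quadSum p = begin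
        _ ≈⟨ ∑-cong (allFin N) (λ a → ∑-cong (allFin N) (λ b → ∑-cong (allFin N) (λ c → ∑-cong (allFin N) (∑≠4-summand p a b c)))) ⟩
        ∑ (allFin N) (λ a → ∑ (allFin N) (λ b → ∑ (allFin N) (λ c → ∑ (allFin N) (λ d → ∑< p (λ j → H p j * T a b c d j)))))
          ≈⟨ ∑-cong (allFin N) (λ a → trans (∑-cong (allFin N) (λ b → trans (∑-cong (allFin N) (λ c →
               ∑-∑<-*ˡ (allFin N) p (H p) (T a b c))) (∑-∑<-*ˡ (allFin N) p (H p) _))) (∑-∑<-*ˡ (allFin N) p (H p) _)) ⟩
        ∑ (allFin N) (λ a → ∑< p (λ j → H p j * ∑ (allFin N) (λ b → ∑ (allFin N) (λ c → ∑ (allFin N) (λ d → T a b c d j)))))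
          ≈⟨ ∑-∑<-*ˡ (allFin N) p (H p) _ ⟩
        ∑< p (λ j → H p j * ∑ (allFin N) (λ a → ∑ (allFin N) (λ b → ∑ (allFin N) (λ c → ∑ (allFin N) (λ d → T a b c d j)))))
          ≈⟨ ∑<-cong p (λ j _ → *-congˡ (∑T≈quadSum j)) ⟩
        ∑< p (λ j → H p j * quadSum j) ∎
        where
        T : Fin N → Fin N → Fin N → Fin N → ℕ → Carrier
        T a b c d j = unless (c ≐ a ∨ c ≐ b) (unless ((d ≐ a ∨ d ≐ b) ∨ d ≐ c) (sq (z a - z b) * (sq (z c - z d) * e₄′ a b c d j)))
        ∑-0-under : ∀ {f : Fin N → Carrier} → (∀ x → f x ≈ 0#) → ∑ (allFin N) f ≈ 0#
        ∑-0-under f≈0 = trans (∑-cong (allFin N) f≈0) (∑-0 (allFin N))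
        ∑T≈quadSum : ∀ j → ∑ (allFin N) (λ a → ∑ (allFin N) (λ b → ∑ (allFin N) (λ c → ∑ (allFin N) (λ d → T a b c d j))))
                           ≈ quadSum j
        ∑T≈quadSum (suc m) = refl
        ∑T≈quadSum zero = ∑-0-under λ a → ∑-0-under λ b → ∑-0-under λ c → ∑-0-under λ d →
          trans (unless-cong (c ≐ a ∨ c ≐ b) (trans (unless-cong ((d ≐ a ∨ d ≐ b) ∨ d ≐ c) (trans (*-congˡ (zeroʳ _)) (zeroʳ _))) (unless-0# _)))
                (unless-0# _)

    ∑≠-sums≈Rhs : ∀ p →
      φ (frac 1 (2 ℕ.* N ℕ.* N)) * ∑≠3 z (λ r s t → sq (z r - z s) * (z r - z t)
                                          * ∑ [ 2 ℕ.+ p ]∖[ 2 ] (h̃E (2 ℕ.+ p) 2 (removing (r ∷ s ∷ t ∷ []))))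
      + φ (frac 1 (8 ℕ.* N ℕ.* N)) * ∑≠4 z (λ a b c d → sq (z a - z b) * sq (z c - z d)
                                          * ∑ [ 2 ℕ.+ p ]∖[ 3 ] (h̃E (2 ℕ.+ p) 3 (removing (a ∷ b ∷ c ∷ d ∷ []))))
      ≈ Rhs p
    ∑≠-sums≈Rhs p = begin
      _ ≈⟨ +-cong (*-congˡ (∑≠3-tripleSum p)) (*-congˡ (∑≠4-quadSum p)) ⟩
      k₁ * ∑< p (λ j → H p j * tripleSum j) + k₂ * ∑< p (λ j → H p j * quadSum j)
        ≈⟨ +-cong (∑<-*ˡ p k₁ _) (∑<-*ˡ p k₂ _) ⟨
      ∑< p (λ j → k₁ * (H p j * tripleSum j)) + ∑< p (λ j → k₂ * (H p j * quadSum j))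
        ≈⟨ ∑<-+ p _ _ ⟨
      ∑< p (λ j → k₁ * (H p j * tripleSum j) + k₂ * (H p j * quadSum j))
        ≈⟨ ∑<-cong p (λ j _ → solve 6 (λ a b h w x y → a :* (h :* w :* x) :+ b :* (h :* w :* y) := w :* (h :* (a :* x :+ b :* y)))
                                      refl k₁ k₂ (φ (h̃ (3 ℕ.+ j) (2 ℕ.+ p) N)) (pow μ (p ℕ.∸ suc j)) (tripleSum j) (quadSum j)) ⟩
      Rhs p ∎
      where
      k₁ = φ (frac 1 (2 ℕ.* N ℕ.* N))
      k₂ = φ (frac 1 (8 ℕ.* N ℕ.* N))

corollary3p11 : {c ℓ : Level} (𝒜 : QAlgebra c ℓ) (n N : ℕ) → 2 ≤ n → n ≤ N →
    (z : Fin N → QAlgebra.Carrier 𝒜) →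
    let open QAlgebra 𝒜
        open Formulas 𝒜
    in  φ (frac 1 (N C n)) * E z ⊤ (+ n) - pow (z̃ z) n
          + φ (frac (n ℕ.* (n ℕ.∸ 1)) (2 ℕ.* N ℕ.* (N ℕ.∸ 1)))
            * ∑ (allFin N) (λ j → sq (z j - z̃ z) * pow (z̃ z) (n ℕ.∸ 2))
        ≈ φ (frac 1 (2 ℕ.* N ℕ.* N))
            * ∑≠3 z (λ r s t → sq (z r - z s) * (z r - z t)
                * ∑ [ n ]∖[ 2 ] (λ k → φ (h̃ k n N) * pow (z̃ z) (n ℕ.∸ k)
                    * E z (removing (r ∷ s ∷ t ∷ [])) (+ k ℤ.- + 3)))
          + φ (frac 1 (8 ℕ.* N ℕ.* N))
            * ∑≠4 z (λ q r s t → sq (z q - z r) * sq (z s - z t)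
                * ∑ [ n ]∖[ 3 ] (λ k → φ (h̃ k n N) * pow (z̃ z) (n ℕ.∸ k)
                    * E z (removing (q ∷ r ∷ s ∷ t ∷ [])) (+ k ℤ.- + 4)))
corollary3p11 𝒜 (suc (suc p)) (suc (suc M)) (s≤s (s≤s z≤n)) (s≤s (s≤s p≤M)) z = begin
  _        ≈⟨ lhs≈Lhs p ⟩
  Lhs p    ≈⟨ Lhs≈Rhs p p≤M ⟩
  Rhs p    ≈⟨ ∑≠-sums≈Rhs p ⟨
  _        ∎
  where
  open SymmetricMeans 𝒜
  open Assembly z
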